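{- Let $k \geq 1$ and $n \geq 3k+2$. The power of a cycle $C_n^k$ has biclique-chromatic number $2$ if and only if there exist natural numbers $a, b \geq 0$ such that $n = ak + b(k+1)$ and $a+b \geq 2$ is even.
   Context: For $k \geq 1$, the power of a cycle $C_n^k$ is the simple graph with vertex set $\{v_0,\dots,v_{n-1}\}$ in which $v_i v_j$ ($i\neq j$) is an edge if and only if $\min\{(j-i) \bmod n, (i-j) \bmod n\} \leq k$. A biclique of a graph is a maximal (under inclusion) set of vertices inducing a complete bipartite subgraph with at least one edge. A biclique-colouring is an assignment of colours to the vertices such that no biclique is monochromatic; the biclique-chromatic number is the least $c$ such that a biclique-colouring with at most $c$ colours exists. -}

module Defs where

open import Data.Nat using (ℕ; _≤_; _<_; _⊓_; _∸_)
open import Data.Nat.Base using (∣_-_∣)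
open import Data.Fin using (Fin; toℕ)
open import Data.Fin.Subset using (Subset; _∈_; _⊆_)
open import Data.Bool using (Bool; true; false)
open import Data.Product using (Σ; ∃; _×_; ∃-syntax)
open import Relation.Binary.PropositionalEquality using (_≡_; _≢_)
open import Relation.Nullary using (¬_)

circDist : (n : ℕ) → Fin n → Fin n → ℕ
circDist n i j = ∣ toℕ i - toℕ j ∣ ⊓ (n ∸ ∣ toℕ i - toℕ j ∣)

Adj : (n k : ℕ) → Fin n → Fin n → Set
Adj n k i j = i ≢ j × circDist n i j ≤ k

Graph : ℕ → Set₁
Graph n = Fin n → Fin n → Set

IsCompleteBipartite : ∀ {n} → Graph n → Subset n → Set
IsCompleteBipartite {n} G S =
  Σ (Fin n → Bool) λ side →
    (∃[ x ] (x ∈ S × side x ≡ true)) ×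
    (∃[ y ] (y ∈ S × side y ≡ false)) ×
    (∀ u v → u ∈ S → v ∈ S → side u ≡ side v → ¬ G u v) ×
    (∀ u v → u ∈ S → v ∈ S → side u ≢ side v → G u v)

IsBiclique : ∀ {n} → Graph n → Subset n → Set
IsBiclique G S =
  IsCompleteBipartite G S × (∀ T → S ⊆ T → IsCompleteBipartite G T → T ⊆ S)

Monochromatic : ∀ {n m} → (Fin n → Fin m) → Subset n → Set
Monochromatic c S = ∀ u v → u ∈ S → v ∈ S → c u ≡ c v

IsBicliqueColouring : ∀ {n m} → Graph n → (Fin n → Fin m) → Set
IsBicliqueColouring G c = ∀ S → IsBiclique G S → ¬ Monochromatic c S

BicliqueColourable : ∀ {n} → Graph n → ℕ → Set
BicliqueColourable {n} G m = Σ (Fin n → Fin m) λ c → IsBicliqueColouring G c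

BicliqueChromaticNumber : ∀ {n} → Graph n → ℕ → Set
BicliqueChromaticNumber G χ =
  BicliqueColourable G χ × (∀ m → m < χ → ¬ BicliqueColourable G m)

-- A 2-colouring of C_n^k is read as an n-periodic sequence of parities along the cycle.
-- Every induced path v, v + i, v + d with i ≤ k < d ≤ i + k (and d + 2k < n) is a biclique,
-- hence not monochromatic.  It follows that each window of k + 1 steps contains a colour
-- change, and (unless n = 4k, where the statement holds anyway) that two changes are never
-- fewer than k steps apart: a run shorter than k forces another one right after it, and such
-- runs are ruled out directly when n > 4k, and for n < 4k either by a vertex whose colour
-- repeats k + 1 steps later or, failing that, by antiperiodicity (using a 4-cycle biclique
-- when n = 3k + 2).  Double counting the m changes over all windows gives km ≤ n ≤ (k + 1)m
-- with m even, i.e. n = ak + b(k + 1) with a + b = m.  Conversely, for such a, b colour v_x by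
-- the parity of ⌊x(a + b)/n⌋: this level rises by at most one over k steps and by at least one
-- over k + 1 steps, so no induced path is monochromatic, and every biclique contains one.

module Submission where

open import Defs
open import Data.Nat
open import Data.Nat.Properties
open import Algebra.Properties.CommutativeSemigroup +-commutativeSemigroup using (interchange; xy∙z≈xz∙y)
open import Data.Nat.DivMod using (_%_; _/_; _mod_; m≡m%n+[m/n]*n; m%n<n; m<n⇒m%n≡m; %-distribˡ-+; [m+n]%n≡m%n; +-distrib-/-∣ʳ; m*n/n≡m; /-monoˡ-≤)
open import Data.Nat.Divisibility using (_∣_; divides; ∣⇒≤; n∣m*n)
open import Data.Nat.Tactic.RingSolver using (solve-∀)
open import Data.Parity.Base as ℙ using (Parity; 0ℙ; 1ℙ; _⁻¹)
import Data.Parity.Properties as ℙ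
open import Data.Fin using (Fin; toℕ; zero; suc) renaming (_≟_ to _≟ᶠ_)
open import Data.Fin.Properties using (toℕ-fromℕ<; toℕ-injective; toℕ<n; any?)
open import Data.Fin.Subset using (Subset; _∈_; _⊆_; ⁅_⁆; _∪_)
open import Data.Fin.Subset.Properties using (x∈⁅x⁆; x∈⁅y⁆⇒x≡y; x∈p∪q⁻; x∈p∪q⁺; _∈?_)
open import Data.Bool using (Bool; true; false)
import Data.Bool.Properties as Bool
open import Data.Product using (_×_; _,_; ∃-syntax; proj₁; proj₂)
open import Data.Sum using (_⊎_; inj₁; inj₂; [_,_]′)
open import Data.Empty using (⊥; ⊥-elim)
open import Function using (_∘_; _∘′_)
open import Function.Bundles using (_⇔_; mk⇔)
open import Relation.Nullary using (¬_; Dec; yes; no; does)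
open import Relation.Nullary.Decidable using (_×-dec_; ¬?; dec-true; dec-false)
open import Relation.Unary using (Pred; Decidable)
open import Relation.Binary.PropositionalEquality
open import Relation.Binary.Definitions using (Tri; tri<; tri≈; tri>)

∑ : ℕ → (ℕ → ℕ) → ℕ
∑ zero    f = 0
∑ (suc N) f = ∑ N f + f N

syntax ∑ N (λ i → e) = ∑[ i < N ] e

∑-cong : ∀ N {f g : ℕ → ℕ} → (∀ {x} → x < N → f x ≡ g x) → ∑ N f ≡ ∑ N g
∑-cong zero    f≗g = refl
∑-cong (suc N) f≗g = cong₂ _+_ (∑-cong N (f≗g ∘′ m<n⇒m<1+n)) (f≗g ≤-refl)

∑-mono-≤ : ∀ N {f g : ℕ → ℕ} → (∀ {x} → x < N → f x ≤ g x) → ∑ N f ≤ ∑ N g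
∑-mono-≤ zero    f≤g = z≤n
∑-mono-≤ (suc N) f≤g = +-mono-≤ (∑-mono-≤ N (λ x<N → f≤g (m<n⇒m<1+n x<N))) (f≤g ≤-refl)

∑-const : ∀ N c → ∑[ _ < N ] c ≡ N * c
∑-const zero    c = refl
∑-const (suc N) c = trans (cong (_+ c) (∑-const N c)) (+-comm (N * c) c)

∑-distrib-+ : ∀ N (f g : ℕ → ℕ) → ∑[ x < N ] (f x + g x) ≡ ∑ N f + ∑ N g
∑-distrib-+ zero    f g = refl
∑-distrib-+ (suc N) f g = trans (cong (_+ (f N + g N)) (∑-distrib-+ N f g)) (interchange (∑ N f) (∑ N g) (f N) (g N))

∑-comm : ∀ N L (h : ℕ → ℕ → ℕ) → ∑[ x < N ] ∑ L (h x) ≡ ∑[ j < L ] ∑[ x < N ] h x j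
∑-comm N zero    h = trans (∑-const N 0) (*-zeroʳ N)
∑-comm N (suc L) h = trans (∑-distrib-+ N (λ x → ∑ L (h x)) (λ x → h x L))
                           (cong (_+ ∑[ x < N ] h x L) (∑-comm N L h))

∑-shift : ∀ N (f : ℕ → ℕ) → ∑[ x < N ] f (suc x) + f 0 ≡ ∑ N f + f N
∑-shift zero    f = refl
∑-shift (suc N) f = trans (xy∙z≈xz∙y (∑[ x < N ] f (suc x)) (f (suc N)) (f 0)) (cong (_+ f (suc N)) (∑-shift N f))

∑-rotate : ∀ N (f : ℕ → ℕ) → (∀ x → f (x + N) ≡ f x) → ∀ j → ∑[ x < N ] f (x + j) ≡ ∑ N f
∑-rotate N f f-periodic zero    = ∑-cong N (λ {x} _ → cong f (+-identityʳ x))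
∑-rotate N f f-periodic (suc j) = begin
  ∑[ x < N ] f (x + suc j) ≡⟨ ∑-cong N (λ {x} _ → cong f (+-suc x j)) ⟩
  ∑[ x < N ] g (suc x)     ≡⟨ +-cancelʳ-≡ (g 0) _ _ (trans (∑-shift N g) (cong (∑ N g +_) gN≡g0)) ⟩
  ∑ N g                    ≡⟨ ∑-rotate N f f-periodic j ⟩
  ∑ N f                    ∎
  where
  open ≡-Reasoning
  g : ℕ → ℕ
  g x = f (x + j)
  gN≡g0 : g N ≡ g 0
  gN≡g0 = trans (cong f (+-comm N j)) (f-periodic j)

term≤∑ : ∀ N (f : ℕ → ℕ) {x} → x < N → f x ≤ ∑ N f
term≤∑ (suc N) f {x} x<1+N with m<1+n⇒m<n∨m≡n x<1+N
... | inj₁ x<N  = ≤-trans (term≤∑ N f x<N) (m≤m+n (∑ N f) (f N))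
... | inj₂ refl = m≤n+m (f x) (∑ N f)

∑≤1 : ∀ N (f : ℕ → ℕ) → (∀ x → f x ≤ 1) →
      (∀ {x y} → x < y → y < N → f x ≡ 1 → f y ≡ 1 → ⊥) → ∑ N f ≤ 1
∑≤1 zero    f f≤1 noPair = z≤n
∑≤1 (suc N) f f≤1 noPair with n≤1⇒n≡0∨n≡1 (f≤1 N)
... | inj₁ fN≡0 = begin
  ∑ N f + f N ≡⟨ cong (∑ N f +_) fN≡0 ⟩
  ∑ N f + 0   ≡⟨ +-identityʳ (∑ N f) ⟩
  ∑ N f       ≤⟨ ∑≤1 N f f≤1 (λ x<y y<N → noPair x<y (m<n⇒m<1+n y<N)) ⟩
  1           ∎
  where open ≤-Reasoning
... | inj₂ fN≡1 = ≤-reflexive (cong₂ _+_ earlier≡0 fN≡1)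
  where
  earlier≡0 : ∑ N f ≡ 0
  earlier≡0 = trans (∑-cong N term≡0) (trans (∑-const N 0) (*-zeroʳ N))
    where
    term≡0 : ∀ {x} → x < N → f x ≡ 0
    term≡0 {x} x<N with n≤1⇒n≡0∨n≡1 (f≤1 x)
    ... | inj₁ fx≡0 = fx≡0
    ... | inj₂ fx≡1 = ⊥-elim (noPair x<N ≤-refl fx≡1 fN≡1)

module _ {p} {P : Pred ℕ p} (P? : Decidable P) where

  private
    leastBelow : ∀ N → (∃[ r ] (r < N × P r × ∀ {s} → s < r → ¬ P s)) ⊎ (∀ {s} → s < N → ¬ P s)
    leastBelow zero = inj₂ λ ()
    leastBelow (suc N) with leastBelow N
    ... | inj₁ (r , r<N , Pr , minimal) = inj₁ (r , m<n⇒m<1+n r<N , Pr , minimal)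
    ... | inj₂ none with P? N
    ...   | yes PN = inj₁ (N , ≤-refl , PN , none)
    ...   | no ¬PN = inj₂ λ s<1+N → [ none , (λ { refl → ¬PN }) ]′ (m<1+n⇒m<n∨m≡n s<1+N)

  least-witness : ∀ {j} → P j → ∃[ r ] (r ≤ j × P r × ∀ {s} → s < r → ¬ P s)
  least-witness {j} Pj with leastBelow (suc j)
  ... | inj₁ (r , r<1+j , Pr , minimal) = r , m<1+n⇒m≤n r<1+j , Pr , minimal
  ... | inj₂ none = ⊥-elim (none ≤-refl Pj)

EvenPartition : ℕ → ℕ → Set
EvenPartition n k = ∃[ a ] ∃[ b ] (n ≡ a * k + b * (k + 1) × 2 ≤ a + b × 2 ∣ a + b)

bounds⇒evenPartition : ∀ {n k m} → 2 ∣ m → 1 ≤ n → k * m ≤ n → n ≤ suc k * m → EvenPartition n k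
bounds⇒evenPartition {n} {k} {m} (divides h m≡h*2) 1≤n km≤n n≤[1+k]m =
  m ∸ b , b , n≡ak+b[k+1] , 2≤m , divides h (trans a+b≡m m≡h*2)
  where
  b = n ∸ k * m
  b≤m : b ≤ m
  b≤m = subst (b ≤_) (m+n∸n≡m m (k * m)) (∸-monoˡ-≤ (k * m) n≤[1+k]m)
  a+b≡m : m ∸ b + b ≡ m
  a+b≡m = m∸n+n≡m b≤m
  regroup : ∀ a b k → a * k + b * (k + 1) ≡ k * (a + b) + b
  regroup = solve-∀
  n≡ak+b[k+1] : n ≡ (m ∸ b) * k + b * (k + 1)
  n≡ak+b[k+1] = sym (begin
    (m ∸ b) * k + b * (k + 1) ≡⟨ regroup (m ∸ b) b k ⟩
    k * (m ∸ b + b) + b       ≡⟨ cong (λ x → k * x + b) a+b≡m ⟩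
    k * m + b                 ≡⟨ m+[n∸m]≡n km≤n ⟩
    n                         ∎)
    where open ≡-Reasoning
  1≤m : 1 ≤ m
  1≤m = n≢0⇒n>0 λ { refl → <-irrefl refl (≤-trans 1≤n (subst (n ≤_) (*-zeroʳ (suc k)) n≤[1+k]m)) }
  2≤m : 2 ≤ m ∸ b + b
  2≤m = subst (2 ≤_) (sym a+b≡m) (∣⇒≤ {{>-nonZero 1≤m}} (divides h m≡h*2))

bit : Parity → ℕ
bit 0ℙ = 0
bit 1ℙ = 1

parity-bit : ∀ p → parity (bit p) ≡ p
parity-bit 0ℙ = refl
parity-bit 1ℙ = refl

parity≡0ℙ⇒2∣ : ∀ m → parity m ≡ 0ℙ → 2 ∣ m
parity≡0ℙ⇒2∣ zero          _  = divides 0 refl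
parity≡0ℙ⇒2∣ (suc (suc m)) eq with parity≡0ℙ⇒2∣ m eq
... | divides h m≡h*2 = divides (suc h) (cong (2 +_) m≡h*2)

2∣⇒parity≡0ℙ : ∀ {m} → 2 ∣ m → parity m ≡ 0ℙ
2∣⇒parity≡0ℙ (divides h refl) = trans (ℙ.*-homo-* h 2) (ℙ.*-zeroʳ (parity h))

≢⇒≡⁻¹ : ∀ {p q : Parity} → p ≢ q → q ≡ p ⁻¹
≢⇒≡⁻¹ {0ℙ} {0ℙ} p≢q = ⊥-elim (p≢q refl)
≢⇒≡⁻¹ {0ℙ} {1ℙ} _   = refl
≢⇒≡⁻¹ {1ℙ} {0ℙ} _   = refl
≢⇒≡⁻¹ {1ℙ} {1ℙ} p≢q = ⊥-elim (p≢q refl)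

module PeriodicSequence (n : ℕ) (c : ℕ → Parity) (c-periodic : ∀ u → c (u + n) ≡ c u) where

  change : ℕ → ℕ
  change u = bit (c u ℙ.+ c (suc u))

  changesIn : ℕ → ℕ → ℕ
  changesIn L x = ∑[ j < L ] change (x + j)

  totalChanges : ℕ
  totalChanges = ∑ n change

  change≤1 : ∀ u → change u ≤ 1
  change≤1 u with c u | c (suc u)
  ... | 0ℙ | 0ℙ = z≤n
  ... | 0ℙ | 1ℙ = ≤-refl
  ... | 1ℙ | 0ℙ = ≤-refl
  ... | 1ℙ | 1ℙ = z≤n

  change≢1⇒≡0 : ∀ u → change u ≢ 1 → change u ≡ 0
  change≢1⇒≡0 u change≢1 with n≤1⇒n≡0∨n≡1 (change≤1 u)
  ... | inj₁ change≡0 = change≡0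
  ... | inj₂ change≡1 = ⊥-elim (change≢1 change≡1)

  change≡0⇒same : ∀ u → change u ≡ 0 → c (suc u) ≡ c u
  change≡0⇒same u with c u | c (suc u)
  ... | 0ℙ | 0ℙ = λ _ → refl
  ... | 1ℙ | 1ℙ = λ _ → refl

  change≡1⇒flip : ∀ u → change u ≡ 1 → c (suc u) ≡ c u ⁻¹
  change≡1⇒flip u with c u | c (suc u)
  ... | 0ℙ | 1ℙ = λ _ → refl
  ... | 1ℙ | 0ℙ = λ _ → refl

  same⇒change≡0 : ∀ u → c (suc u) ≡ c u → change u ≡ 0
  same⇒change≡0 u eq with c u | c (suc u)
  ... | 0ℙ | 0ℙ = refl
  ... | 1ℙ | 1ℙ = refl
  ... | 0ℙ | 1ℙ = ⊥-elim (ℙ.p≢p⁻¹ 0ℙ (sym eq))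
  ... | 1ℙ | 0ℙ = ⊥-elim (ℙ.p≢p⁻¹ 1ℙ (sym eq))

  differ⇒change≡1 : ∀ u → c u ≢ c (suc u) → change u ≡ 1
  differ⇒change≡1 u differ with c u | c (suc u)
  ... | 0ℙ | 0ℙ = ⊥-elim (differ refl)
  ... | 0ℙ | 1ℙ = refl
  ... | 1ℙ | 0ℙ = refl
  ... | 1ℙ | 1ℙ = ⊥-elim (differ refl)

  differ⇒change : ∀ L x → c x ≢ c (x + L) → ∃[ j ] (j < L × change (x + j) ≡ 1)
  differ⇒change zero    x differ = ⊥-elim (differ (cong c (sym (+-identityʳ x))))
  differ⇒change (suc L) x differ with c x ℙ.≟ c (x + L)
  ... | yes same = L , ≤-refl , differ⇒change≡1 (x + L) λ eq →
    differ (trans same (trans eq (cong c (sym (+-suc x L)))))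
  ... | no differ′ with differ⇒change L x differ′
  ...   | j , j<L , changeAt = j , m<n⇒m<1+n j<L , changeAt

  c-periodic* : ∀ t u → c (u + t * n) ≡ c u
  c-periodic* zero    u = cong c (+-identityʳ u)
  c-periodic* (suc t) u = begin
    c (u + (n + t * n)) ≡⟨ cong c (sym (+-assoc u n (t * n))) ⟩
    c (u + n + t * n)   ≡⟨ c-periodic* t (u + n) ⟩
    c (u + n)           ≡⟨ c-periodic u ⟩
    c u                 ∎
    where open ≡-Reasoning

  change-periodic : ∀ u → change (u + n) ≡ change u
  change-periodic u = cong₂ (λ p q → bit (p ℙ.+ q)) (c-periodic u) (c-periodic (suc u))

  parity-changes : ∀ N → parity (∑ N change) ≡ c 0 ℙ.+ c N
  parity-changes zero    = sym (ℙ.p+p≡0ℙ (c 0))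
  parity-changes (suc N) = begin
    parity (∑ N change + change N)               ≡⟨ ℙ.+-homo-+ (∑ N change) (change N) ⟩
    parity (∑ N change) ℙ.+ parity (change N)    ≡⟨ cong₂ ℙ._+_ (parity-changes N) (parity-bit _) ⟩
    (c 0 ℙ.+ c N) ℙ.+ (c N ℙ.+ c (suc N))        ≡⟨ ℙ.+-assoc (c 0) (c N) _ ⟩
    c 0 ℙ.+ (c N ℙ.+ (c N ℙ.+ c (suc N)))        ≡⟨ cong (c 0 ℙ.+_) (sym (ℙ.+-assoc (c N) (c N) _)) ⟩
    c 0 ℙ.+ ((c N ℙ.+ c N) ℙ.+ c (suc N))        ≡⟨ cong (λ p → c 0 ℙ.+ (p ℙ.+ c (suc N))) (ℙ.p+p≡0ℙ (c N)) ⟩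
    c 0 ℙ.+ c (suc N)                            ∎
    where open ≡-Reasoning

  totalChanges-even : 2 ∣ totalChanges
  totalChanges-even = parity≡0ℙ⇒2∣ totalChanges (begin
    parity totalChanges ≡⟨ parity-changes n ⟩
    c 0 ℙ.+ c n         ≡⟨ cong (c 0 ℙ.+_) (c-periodic 0) ⟩
    c 0 ℙ.+ c 0         ≡⟨ ℙ.p+p≡0ℙ (c 0) ⟩
    0ℙ                  ∎)
    where open ≡-Reasoning

  ∑-changesIn : ∀ L → ∑[ x < n ] changesIn L x ≡ L * totalChanges
  ∑-changesIn L = begin
    ∑[ x < n ] ∑[ j < L ] change (x + j) ≡⟨ ∑-comm n L (λ x j → change (x + j)) ⟩
    ∑[ j < L ] ∑[ x < n ] change (x + j) ≡⟨ ∑-cong L (λ {j} _ → ∑-rotate n change change-periodic j) ⟩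
    ∑[ _ < L ] totalChanges              ≡⟨ ∑-const L totalChanges ⟩
    L * totalChanges                     ∎
    where open ≡-Reasoning

  everyWindowChanges⇒n≤ : ∀ L → (∀ x → 1 ≤ changesIn L x) → n ≤ L * totalChanges
  everyWindowChanges⇒n≤ L 1≤changes = begin
    n                       ≡⟨ sym (*-identityʳ n) ⟩
    n * 1                   ≡⟨ sym (∑-const n 1) ⟩
    ∑[ _ < n ] 1            ≤⟨ ∑-mono-≤ n (λ {x} _ → 1≤changes x) ⟩
    ∑[ x < n ] changesIn L x ≡⟨ ∑-changesIn L ⟩
    L * totalChanges        ∎
    where open ≤-Reasoning

  windowsChangeAtMostOnce⇒≤n : ∀ L → (∀ x → changesIn L x ≤ 1) → L * totalChanges ≤ n
  windowsChangeAtMostOnce⇒≤n L changes≤1 = begin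
    L * totalChanges         ≡⟨ sym (∑-changesIn L) ⟩
    ∑[ x < n ] changesIn L x ≤⟨ ∑-mono-≤ n (λ {x} _ → changes≤1 x) ⟩
    ∑[ _ < n ] 1             ≡⟨ ∑-const n 1 ⟩
    n * 1                    ≡⟨ *-identityʳ n ⟩
    n                        ∎
    where open ≤-Reasoning

3k+2≤n⇒0<n : ∀ k {n} → 3 * k + 2 ≤ n → 0 < n
3k+2≤n⇒0<n k 3k+2≤n = ≤-trans (s≤s z≤n) (≤-trans (m≤n+m 2 (3 * k)) 3k+2≤n)

3k+2≤n⇒1+k+[1+2k]≤n : ∀ k {n} → 3 * k + 2 ≤ n → suc k + suc (2 * k) ≤ n
3k+2≤n⇒1+k+[1+2k]≤n k {n} = subst (_≤ n) (regroup k)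
  where
  regroup : ∀ k → 3 * k + 2 ≡ suc k + suc (2 * k)
  regroup = solve-∀

-- The induced paths and 4-cycles of C_n^k that `path-biclique` and `square-biclique` show to be
-- bicliques, written as offsets along a colour sequence.
AvoidsPaths : ℕ → ℕ → (ℕ → Parity) → Set
AvoidsPaths n k c = ∀ q i d → 1 ≤ i → i ≤ k → d ≤ i + k → suc k ≤ d → d + suc (2 * k) ≤ n →
  c q ≡ c (q + i) → c q ≡ c (q + d) → ⊥

AvoidsSquares : ℕ → ℕ → (ℕ → Parity) → Set
AvoidsSquares n k c = n ≡ 3 * k + 2 → 2 ≤ k → ∀ q →
  c q ≡ c (q + k) → c q ≡ c (q + (k + 2)) → c q ≡ c (q + (2 * k + 2)) → ⊥

module Necessity (n k : ℕ) (c : ℕ → Parity) (c-periodic : ∀ u → c (u + n) ≡ c u)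
                 (1≤k : 1 ≤ k) (3k+2≤n : 3 * k + 2 ≤ n)
                 (avoidsPaths : AvoidsPaths n k c) (avoidsSquares : AvoidsSquares n k c) where

  open PeriodicSequence n c c-periodic

  pathBound : suc k + suc (2 * k) ≤ n
  pathBound = 3k+2≤n⇒1+k+[1+2k]≤n k 3k+2≤n

  record ShortRun (y r : ℕ) : Set where
    field
      start   : change y ≡ 1
      1≤r     : 1 ≤ r
      r<k     : r < k
      end     : change (y + r) ≡ 1
      between : ∀ {t} → 1 ≤ t → t < r → change (y + t) ≡ 0

  module _ {y r : ℕ} (run : ShortRun y r) where
    open ShortRun run

    shortRun-inside : ∀ {t} → 1 ≤ t → t ≤ r → c (y + t) ≡ c y ⁻¹
    shortRun-inside {suc zero}    _ _     = trans (cong c (+-comm y 1)) (change≡1⇒flip y start)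
    shortRun-inside {suc (suc t)} _ 2+t≤r = begin
      c (y + suc (suc t)) ≡⟨ cong c (+-suc y (suc t)) ⟩
      c (suc (y + suc t)) ≡⟨ change≡0⇒same (y + suc t) (between (s≤s z≤n) 2+t≤r) ⟩
      c (y + suc t)       ≡⟨ shortRun-inside (s≤s z≤n) (<⇒≤ 2+t≤r) ⟩
      c y ⁻¹              ∎
      where open ≡-Reasoning

    shortRun-after : c (y + suc r) ≡ c y
    shortRun-after = begin
      c (y + suc r)    ≡⟨ cong c (+-suc y r) ⟩
      c (suc (y + r))  ≡⟨ change≡1⇒flip (y + r) end ⟩
      c (y + r) ⁻¹     ≡⟨ cong _⁻¹ (shortRun-inside 1≤r ≤-refl) ⟩
      c y ⁻¹ ⁻¹        ≡⟨ ℙ.⁻¹-involutive (c y) ⟩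
      c y              ∎
      where open ≡-Reasoning

    shortRun-far : c (y + suc k) ≡ c y ⁻¹
    shortRun-far = ≢⇒≡⁻¹ λ same → avoidsPaths y (suc r) (suc k) (s≤s z≤n) r<k
      (s≤s (m≤n+m k r)) ≤-refl pathBound (sym shortRun-after) same

  closeChanges⇒shortRun : ∀ {y j} → change y ≡ 1 → 1 ≤ j → j < k → change (y + j) ≡ 1 →
                          ∃[ r ] ShortRun y r
  closeChanges⇒shortRun {y} {suc j} start _ j<k end
    with least-witness (λ t → change (y + suc t) ≟ 1) end
  ... | r , r≤j , end′ , minimal = suc r , record
    { start   = start
    ; 1≤r     = s≤s z≤n
    ; r<k     = ≤-<-trans (s≤s r≤j) j<k
    ; end     = end′
    ; between = λ { {suc t} _ t<r → change≢1⇒≡0 (y + suc t) (minimal (≤-pred t<r)) }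
    }

  shortRun-next : ∀ {y r} → ShortRun y r → ∃[ r′ ] ShortRun (y + r) r′
  shortRun-next {y} {r} run with m≤n⇒∃[o]m+o≡n (<⇒≤ (ShortRun.r<k run))
  ... | i , r+i≡k with differ⇒change i (y + suc r) differ
    where
    differ : c (y + suc r) ≢ c (y + suc r + i)
    differ same = ℙ.p≢p⁻¹ (c y) (begin
      c y                  ≡⟨ sym (shortRun-after run) ⟩
      c (y + suc r)        ≡⟨ same ⟩
      c (y + suc r + i)    ≡⟨ cong c (trans (+-assoc y (suc r) i) (cong (λ z → y + suc z) r+i≡k)) ⟩
      c (y + suc k)        ≡⟨ shortRun-far run ⟩
      c y ⁻¹               ∎)
      where open ≡-Reasoning
  ... | j , j<i , changeAt = closeChanges⇒shortRun (ShortRun.end run) (s≤s z≤n) 1+j<k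
      (subst (λ z → change z ≡ 1) (regroup y r j) changeAt)
    where
    regroup : ∀ y r j → y + suc r + j ≡ y + r + suc j
    regroup = solve-∀
    1+j<k : suc j < k
    1+j<k = subst (suc (suc j) ≤_) r+i≡k (+-mono-≤ (ShortRun.1≤r run) j<i)

  shortRun-covers : ∀ {b r} X → ShortRun b r → b ≤ X → ∃[ y ] ∃[ r′ ] (ShortRun y r′ × y ≤ X × X < y + r′)
  shortRun-covers {b} X run b≤X = go (suc X) (m≤n+m (suc X) b) run b≤X
    where
    -- each step moves the start forward by r ≥ 1, so X + 1 steps suffice
    go : ∀ F {b r} → X < b + F → ShortRun b r → b ≤ X → ∃[ y ] ∃[ r′ ] (ShortRun y r′ × y ≤ X × X < y + r′)
    go zero    {b}     X<b+0   _   b≤X = ⊥-elim (<⇒≱ (subst (X <_) (+-identityʳ b) X<b+0) b≤X)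
    go (suc F) {b} {r} X<b+1+F run b≤X with X <? b + r
    ... | yes X<b+r = b , r , run , b≤X , X<b+r
    ... | no X≮b+r = go F X<b+r+F (proj₂ (shortRun-next run)) (≮⇒≥ X≮b+r)
      where
      X<b+r+F : X < b + r + F
      X<b+r+F = ≤-trans X<b+1+F (subst (b + suc F ≤_) (sym (+-assoc b r F))
                  (+-monoʳ-≤ b (+-monoˡ-≤ F (ShortRun.1≤r run))))

  shortRun-shift : ∀ {y r} → ShortRun y r → ShortRun (y + n) r
  shortRun-shift {y} {r} run = record
    { start   = trans (change-periodic y) start
    ; 1≤r     = 1≤r
    ; r<k     = r<k
    ; end     = trans (cong change (regroup y n r)) (trans (change-periodic (y + r)) end)
    ; between = λ {t} 1≤t t<r → trans (cong change (regroup y n t)) (trans (change-periodic (y + t)) (between 1≤t t<r))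
    }
    where
    open ShortRun run
    regroup : ∀ y n r → y + n + r ≡ y + r + n
    regroup = solve-∀

  instance
    n-nonZero : NonZero n
    n-nonZero = >-nonZero (3k+2≤n⇒0<n k 3k+2≤n)

  noShortRun-if-repeat : ∀ {x₀} → c x₀ ≡ c (x₀ + suc k) → ∀ {b r} → ¬ ShortRun b r
  noShortRun-if-repeat {x₀} repeat₀ {b} run = noRunAcross (shortRun-covers X run b≤X)
    where
    X = x₀ + b * n
    b≤X : b ≤ X
    b≤X = ≤-trans (m≤m*n b n) (m≤n+m (b * n) x₀)
    repeat : c X ≡ c (X + suc k)
    repeat = begin
      c (x₀ + b * n)           ≡⟨ c-periodic* b x₀ ⟩
      c x₀                     ≡⟨ repeat₀ ⟩
      c (x₀ + suc k)           ≡⟨ sym (c-periodic* b (x₀ + suc k)) ⟩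
      c (x₀ + suc k + b * n)   ≡⟨ cong c (regroup x₀ (suc k) (b * n)) ⟩
      c (X + suc k)            ∎
      where
      open ≡-Reasoning
      regroup : ∀ x s t → x + s + t ≡ x + t + s
      regroup = solve-∀
    flipped : ∀ {i} → 1 ≤ i → i ≤ k → c (X + i) ≡ c X ⁻¹
    flipped 1≤i i≤k = ≢⇒≡⁻¹ λ same →
      avoidsPaths X _ (suc k) 1≤i i≤k (+-monoˡ-≤ k 1≤i) ≤-refl pathBound same repeat
    noChange : ∀ {t} → 1 ≤ t → t < k → change (X + t) ≡ 0
    noChange {t} 1≤t t<k = same⇒change≡0 (X + t) (begin
      c (suc (X + t)) ≡⟨ cong c (sym (+-suc X t)) ⟩
      c (X + suc t)   ≡⟨ flipped (s≤s z≤n) t<k ⟩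
      c X ⁻¹          ≡⟨ sym (flipped 1≤t (<⇒≤ t<k)) ⟩
      c (X + t)       ∎)
      where open ≡-Reasoning
    noRunAcross : ∃[ y ] ∃[ r ] (ShortRun y r × y ≤ X × X < y + r) → ⊥
    noRunAcross (y , r , run′ , y≤X , X<y+r) with m≤n⇒∃[o]m+o≡n X<y+r
    ... | o , 1+X+o≡y+r = 0≢1+n (trans (sym (noChange (s≤s z≤n) 1+o<k))
                                       (trans (cong change X+1+o≡y+r) (ShortRun.end run′)))
      where
      X+1+o≡y+r : X + suc o ≡ y + r
      X+1+o≡y+r = trans (+-suc X o) 1+X+o≡y+r
      1+o<k : suc o < k
      1+o<k = +-cancelˡ-< X (suc o) k (subst (_< X + k) (sym X+1+o≡y+r)
                (+-mono-≤-< y≤X (ShortRun.r<k run′)))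

  period2k+2 : (∀ x → c (x + suc k) ≡ c x ⁻¹) → ∀ x → c (x + (2 * k + 2)) ≡ c x
  period2k+2 anti x = begin
    c (x + (2 * k + 2))     ≡⟨ cong c (regroup x k) ⟩
    c (x + suc k + suc k)   ≡⟨ anti (x + suc k) ⟩
    c (x + suc k) ⁻¹        ≡⟨ cong _⁻¹ (anti x) ⟩
    c x ⁻¹ ⁻¹               ≡⟨ ℙ.⁻¹-involutive (c x) ⟩
    c x                     ∎
    where
    open ≡-Reasoning
    regroup : ∀ x k → x + (2 * k + 2) ≡ x + suc k + suc k
    regroup = solve-∀

  3+e≤k : ∀ {e} → 3 * k + 2 + e ≡ n → n < 4 * k → 3 + e ≤ k
  3+e≤k {e} 3k+2+e≡n n<4k = +-cancelˡ-≤ (3 * k) (3 + e) k (begin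
    3 * k + (3 + e)     ≡⟨ regroup k e ⟩
    suc (3 * k + 2 + e) ≡⟨ cong suc 3k+2+e≡n ⟩
    suc n               ≤⟨ n<4k ⟩
    4 * k               ≡⟨ regroup′ k ⟩
    3 * k + k           ∎)
    where
    open ≤-Reasoning
    regroup : ∀ k e → 3 * k + (3 + e) ≡ suc (3 * k + 2 + e)
    regroup = solve-∀
    regroup′ : ∀ k → 4 * k ≡ 3 * k + k
    regroup′ = solve-∀

  antiperiodic-impossible : n < 4 * k → ¬ (∀ x → c (x + suc k) ≡ c x ⁻¹)
  antiperiodic-impossible n<4k anti with m≤n⇒∃[o]m+o≡n 3k+2≤n
  ... | zero , 3k+2+0≡n =
    avoidsSquares n≡3k+2 (≤-trans (n≤1+n 2) (3+e≤k 3k+2+0≡n n<4k)) 0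
      (sym (periodK 0)) (sym c[k+2]≡c0) (sym (period2k+2 anti 0))
    where
    n≡3k+2 : n ≡ 3 * k + 2
    n≡3k+2 = trans (sym 3k+2+0≡n) (+-identityʳ _)
    periodK : ∀ q → c (q + k) ≡ c q
    periodK q = begin
      c (q + k)                   ≡⟨ sym (period2k+2 anti (q + k)) ⟩
      c (q + k + (2 * k + 2))     ≡⟨ cong c (trans (regroup q k) (cong (q +_) (sym n≡3k+2))) ⟩
      c (q + n)                   ≡⟨ c-periodic q ⟩
      c q                         ∎
      where
      open ≡-Reasoning
      regroup : ∀ q k → q + k + (2 * k + 2) ≡ q + (3 * k + 2)
      regroup = solve-∀
    alternating : ∀ u → c (suc u) ≡ c u ⁻¹
    alternating u = trans (sym (periodK (suc u))) (trans (cong c (sym (+-suc u k))) (anti u))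
    c[k+2]≡c0 : c (k + 2) ≡ c 0
    c[k+2]≡c0 = begin
      c (k + 2)    ≡⟨ cong c (+-comm k 2) ⟩
      c (2 + k)    ≡⟨ periodK 2 ⟩
      c 2          ≡⟨ alternating 1 ⟩
      c 1 ⁻¹       ≡⟨ cong _⁻¹ (alternating 0) ⟩
      c 0 ⁻¹ ⁻¹    ≡⟨ ℙ.⁻¹-involutive (c 0) ⟩
      c 0          ∎
      where open ≡-Reasoning
  ... | suc e , 3k+2+e≡n = ℙ.p≢p⁻¹ (c E) (trans (sym (constant (suc k))) (trans (cong c (+-comm (suc k) E)) (anti E)))
    where
    E = suc e
    1+E≤k : suc E ≤ k
    1+E≤k = ≤-trans (m≤n+m (suc E) 2) (3+e≤k 3k+2+e≡n n<4k)
    repeatAt : ∀ q → c (q + (E + k)) ≡ c q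
    repeatAt q = begin
      c (q + (E + k))                 ≡⟨ sym (period2k+2 anti (q + (E + k))) ⟩
      c (q + (E + k) + (2 * k + 2))   ≡⟨ cong c (trans (regroup q E k) (cong (q +_) 3k+2+e≡n)) ⟩
      c (q + n)                       ≡⟨ c-periodic q ⟩
      c q                             ∎
      where
      open ≡-Reasoning
      regroup : ∀ q E k → q + (E + k) + (2 * k + 2) ≡ q + (3 * k + 2 + E)
      regroup = solve-∀
    bound : E + k + suc (2 * k) ≤ n
    bound = subst (E + k + suc (2 * k) ≤_) 3k+2+e≡n
              (≤-trans (≤-reflexive (regroup e k)) (+-monoʳ-≤ (3 * k + 2) (n≤1+n e)))
      where
      regroup : ∀ e k → suc e + k + suc (2 * k) ≡ 3 * k + 2 + e
      regroup = solve-∀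
    flipped : ∀ {q i} → E ≤ i → i ≤ k → c (q + i) ≡ c q ⁻¹
    flipped {q} {i} E≤i i≤k = ≢⇒≡⁻¹ λ same → avoidsPaths q i (E + k) (≤-trans (s≤s z≤n) E≤i) i≤k
      (+-monoˡ-≤ k E≤i) (+-monoˡ-≤ k (s≤s z≤n)) bound same (sym (repeatAt q))
    constant : ∀ t → c (t + E) ≡ c E
    constant zero    = refl
    constant (suc t) = begin
      c (suc (t + E)) ≡⟨ cong c (sym (+-suc t E)) ⟩
      c (t + suc E)   ≡⟨ flipped (n≤1+n E) 1+E≤k ⟩
      c t ⁻¹          ≡⟨ sym (flipped ≤-refl (<⇒≤ 1+E≤k)) ⟩
      c (t + E)       ≡⟨ constant t ⟩
      c E             ∎
      where open ≡-Reasoning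

  c-mod : ∀ x s → c (x % n + s) ≡ c (x + s)
  c-mod x s = begin
    c (x % n + s)               ≡⟨ sym (c-periodic* (x / n) (x % n + s)) ⟩
    c (x % n + s + x / n * n)   ≡⟨ cong c (regroup (x % n) s (x / n * n)) ⟩
    c (x % n + x / n * n + s)   ≡⟨ cong (λ z → c (z + s)) (sym (m≡m%n+[m/n]*n x n)) ⟩
    c (x + s)                   ∎
    where
    open ≡-Reasoning
    regroup : ∀ a s b → a + s + b ≡ a + b + s
    regroup = solve-∀

  noShortRun-small : n < 4 * k → ∀ {y r} → ¬ ShortRun y r
  noShortRun-small n<4k with anyUpTo? (λ x → c x ℙ.≟ c (x + suc k)) n
  ... | yes (_ , _ , repeat) = noShortRun-if-repeat repeat
  ... | no noRepeat = ⊥-elim (antiperiodic-impossible n<4k anti)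
    where
    anti : ∀ x → c (x + suc k) ≡ c x ⁻¹
    anti x = subst₂ (λ p q → q ≡ p ⁻¹)
      (trans (cong c (sym (+-identityʳ (x % n)))) (trans (c-mod x 0) (cong c (+-identityʳ x))))
      (c-mod x (suc k))
      (≢⇒≡⁻¹ λ repeat → noRepeat (x % n , m%n<n x n , repeat))

  -- After shifting the run by n, the vertex q at distance k − r before it starts a
  -- monochromatic path q, q + (k − r) + 1, q + (k − r) + k + 1.
  noShortRun-large : 4 * k < n → ∀ {y r} → ¬ ShortRun y r
  noShortRun-large 4k<n {y} {r} run₀ with m≤n⇒∃[o]m+o≡n (<⇒≤ (ShortRun.r<k run₀))
  ... | i , r+i≡k with m≤n⇒∃[o]m+o≡n i≤Y
    where
    i≤Y : i ≤ y + n
    i≤Y = ≤-trans (subst (i ≤_) r+i≡k (m≤n+m i r))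
            (≤-trans (≤-trans (m≤m+n k (2 * k)) (m≤m+n (3 * k) 2)) (≤-trans 3k+2≤n (m≤n+m n y)))
  ... | q , i+q≡Y = avoidsPaths q (suc i) (suc k + i) (s≤s z≤n) 1+i≤k
      (s≤s (≤-reflexive (+-comm k i))) (m≤m+n (suc k) i) bound
      (trans cq (sym c[q+1+i])) (trans cq (sym c[q+1+k+i]))
    where
    Y = y + n
    run : ShortRun Y r
    run = shortRun-shift run₀
    q+i≡Y : q + i ≡ Y
    q+i≡Y = trans (+-comm q i) i+q≡Y
    1≤i : 1 ≤ i
    1≤i = n≢0⇒n>0 λ { refl → <-irrefl (trans (sym (+-identityʳ r)) r+i≡k) (ShortRun.r<k run) }
    1+i≤k : suc i ≤ k
    1+i≤k = subst (suc i ≤_) r+i≡k (+-monoˡ-≤ i (ShortRun.1≤r run))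
    cq : c q ≡ c Y ⁻¹
    cq = ≢⇒≡⁻¹ λ cY≡cq → avoidsPaths q i (suc k) 1≤i (subst (i ≤_) r+i≡k (m≤n+m i r))
      (+-monoˡ-≤ k 1≤i) ≤-refl pathBound
      (trans (sym cY≡cq) (cong c (sym q+i≡Y)))
      (trans (sym cY≡cq) (trans (sym (shortRun-after run)) (cong c (sym q+1+k≡Y+1+r))))
      where
      q+1+k≡Y+1+r : q + suc k ≡ Y + suc r
      q+1+k≡Y+1+r = begin
        q + suc k       ≡⟨ cong (λ z → q + suc z) (sym r+i≡k) ⟩
        q + suc (r + i) ≡⟨ regroup q r i ⟩
        q + i + suc r   ≡⟨ cong (_+ suc r) q+i≡Y ⟩
        Y + suc r       ∎
        where
        open ≡-Reasoning
        regroup : ∀ q r i → q + suc (r + i) ≡ q + i + suc r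
        regroup = solve-∀
    c[q+1+i] : c (q + suc i) ≡ c Y ⁻¹
    c[q+1+i] = trans (cong c (trans (+-suc q i) (cong suc q+i≡Y))) (change≡1⇒flip Y (ShortRun.start run))
    c[q+1+k+i] : c (q + (suc k + i)) ≡ c Y ⁻¹
    c[q+1+k+i] = trans (cong c (trans (regroup q k i) (cong (_+ suc k) q+i≡Y))) (shortRun-far run)
      where
      regroup : ∀ q k i → q + (suc k + i) ≡ q + i + suc k
      regroup = solve-∀
    bound : suc k + i + suc (2 * k) ≤ n
    bound = begin
      suc k + i + suc (2 * k) ≡⟨ regroup k i ⟩
      suc i + (3 * k + 1)     ≤⟨ +-monoˡ-≤ (3 * k + 1) 1+i≤k ⟩
      k + (3 * k + 1)         ≡⟨ regroup′ k ⟩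
      suc (4 * k)             ≤⟨ 4k<n ⟩
      n                       ∎
      where
      open ≤-Reasoning
      regroup : ∀ k i → suc k + i + suc (2 * k) ≡ suc i + (3 * k + 1)
      regroup = solve-∀
      regroup′ : ∀ k → k + (3 * k + 1) ≡ suc (4 * k)
      regroup′ = solve-∀

  everyLongWindowChanges : ∀ x → 1 ≤ changesIn (suc k) x
  everyLongWindowChanges x with differing
    where
    differing : ∃[ L ] (L ≤ suc k × c x ≢ c (x + L))
    differing with c x ℙ.≟ c (x + 1)
    ... | no differ = 1 , s≤s z≤n , differ
    ... | yes same  = suc k , ≤-refl ,
      avoidsPaths x 1 (suc k) ≤-refl 1≤k ≤-refl ≤-refl pathBound same
  ... | L , L≤1+k , differ with differ⇒change L x differ
  ... | j , j<L , changeAt = subst (_≤ changesIn (suc k) x) changeAt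
      (term≤∑ (suc k) (λ j → change (x + j)) (≤-trans j<L L≤1+k))

  shortWindowsChangeAtMostOnce : (∀ {y r} → ¬ ShortRun y r) → ∀ x → changesIn k x ≤ 1
  shortWindowsChangeAtMostOnce noShortRun x =
    ∑≤1 k (λ j → change (x + j)) (λ j → change≤1 (x + j)) closePair
    where
    closePair : ∀ {e e′} → e < e′ → e′ < k → change (x + e) ≡ 1 → change (x + e′) ≡ 1 → ⊥
    closePair {e} {e′} e<e′ e′<k changeAt changeAt′ with m≤n⇒∃[o]m+o≡n e<e′
    ... | o , 1+e+o≡e′ = noShortRun (proj₂ (closeChanges⇒shortRun changeAt (s≤s z≤n)
      (≤-<-trans (subst (suc o ≤_) 1+e+o≡e′ (s≤s (m≤n+m o e))) e′<k)
      (trans (cong change (trans (+-assoc x e (suc o)) (cong (x +_) (trans (+-suc e o) 1+e+o≡e′)))) changeAt′)))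

  noShortRun⇒evenPartition : (∀ {y r} → ¬ ShortRun y r) → EvenPartition n k
  noShortRun⇒evenPartition noShortRun = bounds⇒evenPartition totalChanges-even (3k+2≤n⇒0<n k 3k+2≤n)
    (windowsChangeAtMostOnce⇒≤n k (shortWindowsChangeAtMostOnce noShortRun))
    (everyWindowChanges⇒n≤ (suc k) everyLongWindowChanges)

  necessity : EvenPartition n k
  necessity with <-cmp n (4 * k)
  ... | tri< n<4k _ _ = noShortRun⇒evenPartition (noShortRun-small n<4k)
  -- the short-run argument fails for n = 4k (alternating colours when k = 2), but 4 · k is a partition
  ... | tri≈ _ n≡4k _ = 4 , 0 , trans n≡4k (sym (+-identityʳ (4 * k))) , s≤s (s≤s z≤n) , divides 2 refl
  ... | tri> _ _ 4k<n = noShortRun⇒evenPartition (noShortRun-large 4k<n)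

module FloorColouring (n k m : ℕ) .{{_ : NonZero n}} (2∣m : 2 ∣ m)
                      (km≤n : k * m ≤ n) (n≤[1+k]m : n ≤ suc k * m) where

  level : ℕ → ℕ
  level x = x * m / n

  colour : ℕ → Parity
  colour x = parity (level x)

  [a+tn]/n≡a/n+t : ∀ a t → (a + t * n) / n ≡ a / n + t
  [a+tn]/n≡a/n+t a t = trans (+-distrib-/-∣ʳ a (n∣m*n t)) (cong (a / n +_) (m*n/n≡m t n))

  level-mono : ∀ {x y} → x ≤ y → level x ≤ level y
  level-mono x≤y = /-monoˡ-≤ n (*-monoˡ-≤ m x≤y)

  level-short : ∀ x {d} → d ≤ k → level (x + d) ≤ suc (level x)
  level-short x {d} d≤k = begin
    (x + d) * m / n     ≡⟨ cong (_/ n) (*-distribʳ-+ m x d) ⟩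
    (x * m + d * m) / n ≤⟨ /-monoˡ-≤ n (+-monoʳ-≤ (x * m) dm≤1*n) ⟩
    (x * m + 1 * n) / n ≡⟨ [a+tn]/n≡a/n+t (x * m) 1 ⟩
    level x + 1         ≡⟨ +-comm (level x) 1 ⟩
    suc (level x)       ∎
    where
    open ≤-Reasoning
    dm≤1*n : d * m ≤ 1 * n
    dm≤1*n = ≤-trans (*-monoˡ-≤ m d≤k) (≤-trans km≤n (≤-reflexive (sym (+-identityʳ n))))

  level-long : ∀ x → suc (level x) ≤ level (x + suc k)
  level-long x = begin
    suc (level x)             ≡⟨ +-comm 1 (level x) ⟩
    level x + 1               ≡⟨ sym ([a+tn]/n≡a/n+t (x * m) 1) ⟩
    (x * m + 1 * n) / n       ≤⟨ /-monoˡ-≤ n (+-monoʳ-≤ (x * m) (≤-trans (≤-reflexive (+-identityʳ n)) n≤[1+k]m)) ⟩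
    (x * m + suc k * m) / n   ≡⟨ cong (_/ n) (sym (*-distribʳ-+ m x (suc k))) ⟩
    level (x + suc k)         ∎
    where open ≤-Reasoning

  level-periodic : ∀ x t → level (x + t * n) ≡ level x + t * m
  level-periodic x t = trans (cong (_/ n) (regroup x t m n)) ([a+tn]/n≡a/n+t (x * m) (t * m))
    where
    regroup : ∀ x t m n → (x + t * n) * m ≡ x * m + t * m * n
    regroup = solve-∀

  colour-mod : ∀ x → colour (x % n) ≡ colour x
  colour-mod x = sym (begin
    colour x                                          ≡⟨ cong colour (m≡m%n+[m/n]*n x n) ⟩
    parity (level (x % n + x / n * n))                ≡⟨ cong parity (level-periodic (x % n) (x / n)) ⟩
    parity (level (x % n) + x / n * m)                ≡⟨ ℙ.+-homo-+ (level (x % n)) (x / n * m) ⟩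
    colour (x % n) ℙ.+ parity (x / n * m)             ≡⟨ cong (colour (x % n) ℙ.+_) (parity[t*m]≡0ℙ (x / n)) ⟩
    colour (x % n) ℙ.+ 0ℙ                             ≡⟨ ℙ.+-identityʳ (colour (x % n)) ⟩
    colour (x % n)                                    ∎)
    where
    open ≡-Reasoning
    parity[t*m]≡0ℙ : ∀ t → parity (t * m) ≡ 0ℙ
    parity[t*m]≡0ℙ t = trans (ℙ.*-homo-* t m)
      (trans (cong (parity t ℙ.*_) (2∣⇒parity≡0ℙ 2∣m)) (ℙ.*-zeroʳ (parity t)))

  sameParity⇒≡ : ∀ {a b} → a ≤ b → b ≤ suc a → parity a ≡ parity b → a ≡ b
  sameParity⇒≡ {a} a≤b b≤1+a same with m≤n⇒m<n∨m≡n b≤1+a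
  ... | inj₁ b<1+a = ≤-antisym a≤b (≤-pred b<1+a)
  ... | inj₂ refl  = ⊥-elim (ℙ.p≢p⁻¹ (parity (suc a)) (trans (sym same) (sym (ℙ.suc-homo-⁻¹ a))))

  no-monochromatic-path : ∀ q {i j} → i ≤ k → j ≤ k → suc k ≤ i + j →
                          colour q ≡ colour (q + i) → colour q ≡ colour (q + (i + j)) → ⊥
  no-monochromatic-path q {i} {j} i≤k j≤k 1+k≤i+j same₁ same₂ =
    <-irrefl level-q≡level-q+i+j (begin-strict
      level q               <⟨ level-long q ⟩
      level (q + suc k)     ≤⟨ level-mono (+-monoʳ-≤ q 1+k≤i+j) ⟩
      level (q + (i + j))   ≡⟨ cong level (sym (+-assoc q i j)) ⟩
      level (q + i + j)     ∎)
    where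
    open ≤-Reasoning
    level-q≡level-q+i+j : level q ≡ level (q + i + j)
    level-q≡level-q+i+j = trans
      (sameParity⇒≡ (level-mono (m≤m+n q i)) (level-short q i≤k) same₁)
      (sameParity⇒≡ (level-mono (m≤m+n (q + i) j)) (level-short (q + i) j≤k)
        (trans (sym same₁) (trans same₂ (cong colour (sym (+-assoc q i j))))))

pair : ∀ {n} → Fin n → Fin n → Subset n
pair x y = ⁅ x ⁆ ∪ ⁅ y ⁆

∈-pairˡ : ∀ {n} (x y : Fin n) → x ∈ pair x y
∈-pairˡ x y = x∈p∪q⁺ (inj₁ (x∈⁅x⁆ x))

∈-pairʳ : ∀ {n} (x y : Fin n) → y ∈ pair x y
∈-pairʳ x y = x∈p∪q⁺ (inj₂ (x∈⁅x⁆ y))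

∈-pair⁻ : ∀ {n} {u x y : Fin n} → u ∈ pair x y → u ≡ x ⊎ u ≡ y
∈-pair⁻ {x = x} {y} u∈ with x∈p∪q⁻ ⁅ x ⁆ ⁅ y ⁆ u∈
... | inj₁ u∈⁅x⁆ = inj₁ (x∈⁅y⁆⇒x≡y x u∈⁅x⁆)
... | inj₂ u∈⁅y⁆ = inj₂ (x∈⁅y⁆⇒x≡y y u∈⁅y⁆)

false≢true : false ≢ true
false≢true ()

≢-same⇒≡ : ∀ {a b c : Bool} → a ≢ c → b ≢ c → a ≡ b
≢-same⇒≡ a≢c b≢c = trans (Bool.¬-not a≢c) (sym (Bool.¬-not b≢c))

module Bicliques {n : ℕ} (G : Graph n) (G-sym : ∀ {x y} → G x y → G y x) (G-irrefl : ∀ x → ¬ G x x) where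

  Independent : Subset n → Set
  Independent A = ∀ {u v} → u ∈ A → v ∈ A → ¬ G u v

  Complete : Subset n → Subset n → Set
  Complete A B = ∀ {a b} → a ∈ A → b ∈ B → G a b

  pair-independent : ∀ {a c} → ¬ G a c → Independent (pair a c)
  pair-independent {a} {c} ¬ac u∈ v∈ with ∈-pair⁻ u∈ | ∈-pair⁻ v∈
  ... | inj₁ refl | inj₁ refl = G-irrefl a
  ... | inj₁ refl | inj₂ refl = ¬ac
  ... | inj₂ refl | inj₁ refl = λ ca → ¬ac (G-sym ca)
  ... | inj₂ refl | inj₂ refl = G-irrefl c

  pairs-complete : ∀ {a c b d} → G a b → G a d → G c b → G c d → Complete (pair a c) (pair b d)
  pairs-complete ab ad cb cd u∈ v∈ with ∈-pair⁻ u∈ | ∈-pair⁻ v∈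
  ... | inj₁ refl | inj₁ refl = ab
  ... | inj₁ refl | inj₂ refl = ad
  ... | inj₂ refl | inj₁ refl = cb
  ... | inj₂ refl | inj₂ refl = cd

  completeBipartite : ∀ {A B a b} → a ∈ A → b ∈ B → Independent A → Independent B → Complete A B →
                      IsCompleteBipartite G (A ∪ B)
  completeBipartite {A} {B} {a} {b} a∈A b∈B indA indB complete =
    side , (b , x∈p∪q⁺ (inj₂ b∈B) , side-B b∈B) , (a , x∈p∪q⁺ (inj₁ a∈A) , side-A a∈A) , indep , cross
    where
    side : Fin n → Bool
    side u = does (u ∈? B)
    side-B : ∀ {u} → u ∈ B → side u ≡ true
    side-B {u} u∈B = dec-true (u ∈? B) u∈B
    side-A : ∀ {u} → u ∈ A → side u ≡ false
    side-A {u} u∈A = dec-false (u ∈? B) λ u∈B → G-irrefl u (complete u∈A u∈B)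
    indep : ∀ u v → u ∈ A ∪ B → v ∈ A ∪ B → side u ≡ side v → ¬ G u v
    indep u v u∈ v∈ same with x∈p∪q⁻ A B u∈ | x∈p∪q⁻ A B v∈
    ... | inj₁ u∈A | inj₁ v∈A = indA u∈A v∈A
    ... | inj₂ u∈B | inj₂ v∈B = indB u∈B v∈B
    ... | inj₁ u∈A | inj₂ v∈B = λ _ → false≢true (trans (sym (side-A u∈A)) (trans same (side-B v∈B)))
    ... | inj₂ u∈B | inj₁ v∈A = λ _ → false≢true (trans (sym (side-A v∈A)) (trans (sym same) (side-B u∈B)))
    cross : ∀ u v → u ∈ A ∪ B → v ∈ A ∪ B → side u ≢ side v → G u v
    cross u v u∈ v∈ differ with x∈p∪q⁻ A B u∈ | x∈p∪q⁻ A B v∈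
    ... | inj₁ u∈A | inj₂ v∈B = complete u∈A v∈B
    ... | inj₂ u∈B | inj₁ v∈A = G-sym (complete v∈A u∈B)
    ... | inj₁ u∈A | inj₁ v∈A = ⊥-elim (differ (trans (side-A u∈A) (sym (side-A v∈A))))
    ... | inj₂ u∈B | inj₂ v∈B = ⊥-elim (differ (trans (side-B u∈B) (sym (side-B v∈B))))

  biclique : ∀ {A B a b} → a ∈ A → b ∈ B → Independent A → Independent B → Complete A B →
    (∀ w → (∀ {u} → u ∈ A → ¬ G w u) → (∀ {u} → u ∈ B → G w u) → w ∈ A ∪ B) →
    (∀ w → (∀ {u} → u ∈ B → ¬ G w u) → (∀ {u} → u ∈ A → G w u) → w ∈ A ∪ B) →
    IsBiclique G (A ∪ B)
  biclique {A} {B} {a} {b} a∈A b∈B indA indB complete closedA closedB =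
    completeBipartite a∈A b∈B indA indB complete , maximal
    where
    module Sides (T : Subset n) (A∪B⊆T : A ∪ B ⊆ T) (τ : Fin n → Bool)
                 (indT : ∀ u v → u ∈ T → v ∈ T → τ u ≡ τ v → ¬ G u v) where
      inT₁ : ∀ {u} → u ∈ A → u ∈ T
      inT₁ u∈A = A∪B⊆T (x∈p∪q⁺ (inj₁ u∈A))
      inT₂ : ∀ {u} → u ∈ B → u ∈ T
      inT₂ u∈B = A∪B⊆T (x∈p∪q⁺ (inj₂ u∈B))
      τa≢τb : τ a ≢ τ b
      τa≢τb same = indT a b (inT₁ a∈A) (inT₂ b∈B) same (complete a∈A b∈B)
      side-of-A : ∀ {u} → u ∈ A → τ u ≡ τ a
      side-of-A u∈A = ≢-same⇒≡ (λ same → indT _ b (inT₁ u∈A) (inT₂ b∈B) same (complete u∈A b∈B)) τa≢τb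
      side-of-B : ∀ {u} → u ∈ B → τ u ≡ τ b
      side-of-B u∈B = ≢-same⇒≡ (λ same → indT a _ (inT₁ a∈A) (inT₂ u∈B) (sym same) (complete a∈A u∈B))
                                (λ τb≡τa → τa≢τb (sym τb≡τa))

    maximal : ∀ T → A ∪ B ⊆ T → IsCompleteBipartite G T → T ⊆ A ∪ B
    maximal T A∪B⊆T (τ , _ , _ , indT , crossT) {w} w∈T with τ w Bool.≟ τ a
    ... | yes τw≡τa = closedA w
      (λ u∈A → indT w _ w∈T (inT₁ u∈A) (trans τw≡τa (sym (side-of-A u∈A))))
      (λ u∈B → crossT w _ w∈T (inT₂ u∈B) λ τw≡τu → τa≢τb (trans (sym τw≡τa) (trans τw≡τu (side-of-B u∈B))))
      where open Sides T A∪B⊆T τ indT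
    ... | no τw≢τa = closedB w
      (λ u∈B → indT w _ w∈T (inT₂ u∈B) (trans τw≡τb (sym (side-of-B u∈B))))
      (λ u∈A → crossT w _ w∈T (inT₁ u∈A) λ τw≡τu → τw≢τa (trans τw≡τu (side-of-A u∈A)))
      where
      open Sides T A∪B⊆T τ indT
      τw≡τb : τ w ≡ τ b
      τw≡τb = ≢-same⇒≡ τw≢τa (λ τb≡τa → τa≢τb (sym τb≡τa))

  -- Covers induced paths a – b – c as the case b = d.
  pairs-biclique : ∀ {a c b d} → G a b → G a d → G c b → G c d → ¬ G a c → ¬ G b d →
    (∀ w → ¬ G w a → ¬ G w c → G w b → G w d → w ≡ a ⊎ w ≡ c) →
    (∀ w → ¬ G w b → ¬ G w d → G w a → G w c → w ≡ b ⊎ w ≡ d) →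
    IsBiclique G (pair a c ∪ pair b d)
  pairs-biclique {a} {c} {b} {d} ab ad cb cd ¬ac ¬bd closedAC closedBD =
    biclique (∈-pairˡ a c) (∈-pairˡ b d) (pair-independent ¬ac) (pair-independent ¬bd)
      (pairs-complete ab ad cb cd)
      (λ w ¬wA wB → x∈p∪q⁺ (inj₁ (∈-pair⁺ (closedAC w (¬wA (∈-pairˡ a c)) (¬wA (∈-pairʳ a c))
                                                    (wB (∈-pairˡ b d)) (wB (∈-pairʳ b d))))))
      (λ w ¬wB wA → x∈p∪q⁺ (inj₂ (∈-pair⁺ (closedBD w (¬wB (∈-pairˡ b d)) (¬wB (∈-pairʳ b d))
                                                    (wA (∈-pairˡ a c)) (wA (∈-pairʳ a c))))))
    where
    ∈-pair⁺ : ∀ {u x y} → u ≡ x ⊎ u ≡ y → u ∈ pair x y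
    ∈-pair⁺ {x = x} {y} (inj₁ refl) = ∈-pairˡ x y
    ∈-pair⁺ {x = x} {y} (inj₂ refl) = ∈-pairʳ x y

  -- A second vertex on either side of S yields an induced path; otherwise S is a single edge,
  -- and adding a private neighbour of one end would enlarge it.
  biclique⇒inducedPath : (∀ {x y} → G x y → ∃[ w ] (G w x × ¬ G w y × w ≢ y)) →
    ∀ {S} → IsBiclique G S →
    ∃[ x ] ∃[ y ] ∃[ z ] (x ∈ S × y ∈ S × z ∈ S × x ≢ z × G x y × G y z × ¬ G x z)
  biclique⇒inducedPath privateNeighbour {S} ((side , (x , x∈S , sx) , (y , y∈S , sy) , indep , cross) , maximal) =
    search (any? λ u → (u ∈? S) ×-dec (¬? (u ≟ᶠ x) ×-dec (side u Bool.≟ true)))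
           (any? λ u → (u ∈? S) ×-dec (¬? (u ≟ᶠ y) ×-dec (side u Bool.≟ false)))
    where
    xy : G x y
    xy = cross x y x∈S y∈S λ same → false≢true (trans (sym sy) (trans (sym same) sx))

    S⊆pair : (∀ {u} → u ∈ S → u ≡ x ⊎ u ≡ y) → ⊥
    S⊆pair endpoints with privateNeighbour xy
    ... | w , wx , ¬wy , w≢y with endpoints (maximal T S⊆T T-bipartite w∈T)
      where
      T = pair x x ∪ pair y w
      T-bipartite : IsCompleteBipartite G T
      T-bipartite = completeBipartite (∈-pairˡ x x) (∈-pairˡ y w) (pair-independent (G-irrefl x))
        (pair-independent λ yw → ¬wy (G-sym yw)) (pairs-complete xy (G-sym wx) xy (G-sym wx))
      S⊆T : S ⊆ T
      S⊆T u∈S with endpoints u∈S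
      ... | inj₁ refl = x∈p∪q⁺ (inj₁ (∈-pairˡ x x))
      ... | inj₂ refl = x∈p∪q⁺ (inj₂ (∈-pairˡ y w))
      w∈T : w ∈ T
      w∈T = x∈p∪q⁺ (inj₂ (∈-pairʳ y w))
    ... | inj₁ refl = G-irrefl x wx
    ... | inj₂ w≡y  = w≢y w≡y

    search : Dec (∃[ u ] (u ∈ S × u ≢ x × side u ≡ true)) → Dec (∃[ u ] (u ∈ S × u ≢ y × side u ≡ false)) →
             ∃[ x ] ∃[ y ] ∃[ z ] (x ∈ S × y ∈ S × z ∈ S × x ≢ z × G x y × G y z × ¬ G x z)
    search (yes (u , u∈S , u≢x , su)) _ =
      x , y , u , x∈S , y∈S , u∈S , (λ x≡u → u≢x (sym x≡u)) , xy ,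
      cross y u y∈S u∈S (λ same → false≢true (trans (sym sy) (trans same su))) ,
      indep x u x∈S u∈S (trans sx (sym su))
    search (no _) (yes (u , u∈S , u≢y , su)) =
      y , x , u , y∈S , x∈S , u∈S , (λ y≡u → u≢y (sym y≡u)) , G-sym xy ,
      cross x u x∈S u∈S (λ same → false≢true (trans (sym su) (trans (sym same) sx))) ,
      indep y u y∈S u∈S (trans sy (sym su))
    search (no noOtherTrue) (no noOtherFalse) = ⊥-elim (S⊆pair endpoints)
      where
      endpoints : ∀ {u} → u ∈ S → u ≡ x ⊎ u ≡ y
      endpoints {u} u∈S with u ≟ᶠ x | u ≟ᶠ y | side u in su
      ... | yes u≡x | _       | _     = inj₁ u≡x
      ... | no _    | yes u≡y | _     = inj₂ u≡y
      ... | no u≢x  | no _    | true  = ⊥-elim (noOtherTrue (u , u∈S , u≢x , su))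
      ... | no _    | no u≢y  | false = ⊥-elim (noOtherFalse (u , u∈S , u≢y , su))

module _ {n m : ℕ} (c : Fin n → Fin m) where

  pairs-monochromatic : ∀ {a b c′ d} → c a ≡ c b → c a ≡ c c′ → c a ≡ c d → Monochromatic c (pair a c′ ∪ pair b d)
  pairs-monochromatic {a} {b} {c′} {d} ab ac ad u v u∈ v∈ = trans (colour≡a u∈) (sym (colour≡a v∈))
    where
    colour≡a : ∀ {u} → u ∈ pair a c′ ∪ pair b d → c u ≡ c a
    colour≡a u∈ with x∈p∪q⁻ (pair a c′) (pair b d) u∈
    ... | inj₁ u∈ac with ∈-pair⁻ u∈ac
    ...   | inj₁ refl = refl
    ...   | inj₂ refl = sym ac
    colour≡a u∈ | inj₂ u∈bd with ∈-pair⁻ u∈bd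
    ...   | inj₁ refl = sym ab
    ...   | inj₂ refl = sym ad

module CyclePower (n k : ℕ) .{{_ : NonZero n}} where

  vertex : ℕ → Fin n
  vertex u = u mod n

  toℕ-vertex : ∀ u → toℕ (vertex u) ≡ u % n
  toℕ-vertex u = toℕ-fromℕ< (m%n<n u n)

  vertex-+n : ∀ u → vertex (u + n) ≡ vertex u
  vertex-+n u = toℕ-injective (trans (toℕ-vertex (u + n)) (trans ([m+n]%n≡m%n u n) (sym (toℕ-vertex u))))

  vertex-toℕ : ∀ x → vertex (toℕ x) ≡ x
  vertex-toℕ x = toℕ-injective (trans (toℕ-vertex (toℕ x)) (m<n⇒m%n≡m (toℕ<n x)))

  vertex-offset : ∀ w q → ∃[ s ] (s < n × w ≡ vertex (q + s))
  vertex-offset w zero    = toℕ w , toℕ<n w , sym (vertex-toℕ w)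
  vertex-offset w (suc q) = step (vertex-offset w q)
    where
    step : ∃[ s ] (s < n × w ≡ vertex (q + s)) → ∃[ s ] (s < n × w ≡ vertex (suc q + s))
    step (suc s , 1+s<n , w≡) = s , <-trans (n<1+n s) 1+s<n , trans w≡ (cong vertex (+-suc q s))
    step (zero  , _     , w≡) = pred n , ≤-reflexive (suc-pred n) , (begin
      w                     ≡⟨ w≡ ⟩
      vertex (q + 0)        ≡⟨ cong vertex (+-identityʳ q) ⟩
      vertex q              ≡⟨ sym (vertex-+n q) ⟩
      vertex (q + n)        ≡⟨ cong (λ z → vertex (q + z)) (sym (suc-pred n)) ⟩
      vertex (q + suc (pred n)) ≡⟨ cong vertex (+-suc q (pred n)) ⟩
      vertex (suc q + pred n)   ∎)
      where open ≡-Reasoning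

  toℕ-vertex-+ : ∀ u {t} → t < n → toℕ (vertex (u + t)) ≡ (u % n + t) % n
  toℕ-vertex-+ u {t} t<n =
    trans (toℕ-vertex (u + t)) (trans (%-distribˡ-+ u t n) (cong (λ z → (u % n + z) % n) (m<n⇒m%n≡m t<n)))

  wrap : ∀ u {t} → t < n → toℕ (vertex (u + t)) ≡ u % n + t ⊎ toℕ (vertex (u + t)) + n ≡ u % n + t
  wrap u {t} t<n with u % n + t <? n
  ... | yes a+t<n = inj₁ (trans (toℕ-vertex-+ u t<n) (m<n⇒m%n≡m a+t<n))
  ... | no a+t≮n with m≤n⇒∃[o]m+o≡n (≮⇒≥ a+t≮n)
  ...   | w , n+w≡a+t = inj₂ (begin
    toℕ (vertex (u + t)) + n ≡⟨ cong (_+ n) (toℕ-vertex-+ u t<n) ⟩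
    (u % n + t) % n + n      ≡⟨ cong (λ z → z % n + n) (trans (sym n+w≡a+t) (+-comm n w)) ⟩
    (w + n) % n + n          ≡⟨ cong (_+ n) (trans ([m+n]%n≡m%n w n) (m<n⇒m%n≡m w<n)) ⟩
    w + n                    ≡⟨ trans (+-comm w n) n+w≡a+t ⟩
    u % n + t                ∎)
    where
    open ≡-Reasoning
    w<n : w < n
    w<n = +-cancelˡ-< n w n (subst (_< n + n) (sym n+w≡a+t) (+-mono-< (m%n<n u n) t<n))

  circDist-offset : ∀ u {t} → t < n → circDist n (vertex u) (vertex (u + t)) ≡ t ⊓ (n ∸ t)
  circDist-offset u {t} t<n with wrap u t<n
  ... | inj₁ b≡a+t = cong (λ d → d ⊓ (n ∸ d))
        (trans (cong₂ ∣_-_∣ (toℕ-vertex u) b≡a+t) (∣m-m+n∣≡n (u % n) t))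
  ... | inj₂ b+n≡a+t = begin
    ∣ toℕ (vertex u) - b ∣ ⊓ (n ∸ ∣ toℕ (vertex u) - b ∣) ≡⟨ cong (λ d → d ⊓ (n ∸ d)) ∣a-b∣≡n∸t ⟩
    (n ∸ t) ⊓ (n ∸ (n ∸ t))                               ≡⟨ cong ((n ∸ t) ⊓_) (m∸[m∸n]≡n (<⇒≤ t<n)) ⟩
    (n ∸ t) ⊓ t                                           ≡⟨ ⊓-comm (n ∸ t) t ⟩
    t ⊓ (n ∸ t)                                           ∎
    where
    open ≡-Reasoning
    b = toℕ (vertex (u + t))
    a≡b+[n∸t] : u % n ≡ b + (n ∸ t)
    a≡b+[n∸t] = +-cancelʳ-≡ t _ _ (begin
      u % n + t         ≡⟨ sym b+n≡a+t ⟩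
      b + n             ≡⟨ cong (b +_) (sym (m∸n+n≡m (<⇒≤ t<n))) ⟩
      b + (n ∸ t + t)   ≡⟨ sym (+-assoc b (n ∸ t) t) ⟩
      b + (n ∸ t) + t   ∎)
    ∣a-b∣≡n∸t : ∣ toℕ (vertex u) - b ∣ ≡ n ∸ t
    ∣a-b∣≡n∸t = trans (cong (∣_- b ∣) (trans (toℕ-vertex u) a≡b+[n∸t]))
                      (trans (∣-∣-comm (b + (n ∸ t)) b) (∣m-m+n∣≡n b (n ∸ t)))

  vertex-offset-injective : ∀ u {t} → t < n → vertex u ≡ vertex (u + t) → t ≡ 0
  vertex-offset-injective u {t} t<n eq with wrap u t<n
  ... | inj₁ b≡a+t = +-cancelˡ-≡ (u % n) t 0 (begin
    u % n + t                ≡⟨ sym b≡a+t ⟩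
    toℕ (vertex (u + t))     ≡⟨ cong toℕ (sym eq) ⟩
    toℕ (vertex u)           ≡⟨ toℕ-vertex u ⟩
    u % n                    ≡⟨ sym (+-identityʳ (u % n)) ⟩
    u % n + 0                ∎)
    where open ≡-Reasoning
  ... | inj₂ b+n≡a+t = ⊥-elim (<-irrefl (+-cancelˡ-≡ (u % n) t n (begin
    u % n + t                ≡⟨ sym b+n≡a+t ⟩
    toℕ (vertex (u + t)) + n ≡⟨ cong (λ x → toℕ x + n) (sym eq) ⟩
    toℕ (vertex u) + n       ≡⟨ cong (_+ n) (toℕ-vertex u) ⟩
    u % n + n                ∎)) t<n)
    where open ≡-Reasoning

  Adj-sym : ∀ {x y} → Adj n k x y → Adj n k y x
  Adj-sym {x} {y} (x≢y , d≤k) = (λ y≡x → x≢y (sym y≡x)) ,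
    subst (_≤ k) (cong (λ d → d ⊓ (n ∸ d)) (∣-∣-comm (toℕ x) (toℕ y))) d≤k

  Adj-irrefl : ∀ x → ¬ Adj n k x x
  Adj-irrefl x (x≢x , _) = x≢x refl

  -- Offsets s < s′ from a common base are adjacent iff s′ − s ≤ k or n − (s′ − s) ≤ k;
  -- stated without subtraction.
  Near : ℕ → ℕ → Set
  Near s s′ = s′ ≤ s + k ⊎ s + n ≤ s′ + k

  offset⇒adj : ∀ u {t} → 1 ≤ t → t < n → Near 0 t → Adj n k (vertex u) (vertex (u + t))
  offset⇒adj u {t} 1≤t t<n near =
    (λ eq → <-irrefl (sym (vertex-offset-injective u t<n eq)) 1≤t) ,
    subst (_≤ k) (sym (circDist-offset u t<n)) (minDist≤k near)
    where
    minDist≤k : Near 0 t → t ⊓ (n ∸ t) ≤ k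
    minDist≤k (inj₁ t≤k)   = ≤-trans (m⊓n≤m t (n ∸ t)) t≤k
    minDist≤k (inj₂ n≤t+k) = ≤-trans (m⊓n≤n t (n ∸ t)) (m≤n+o⇒m∸n≤o n t n≤t+k)

  adj⇒offset : ∀ u {t} → t < n → Adj n k (vertex u) (vertex (u + t)) → Near 0 t
  adj⇒offset u {t} t<n (_ , d≤k) with ⊓-sel t (n ∸ t)
  ... | inj₁ min≡t   = inj₁ (subst (_≤ k) (trans (circDist-offset u t<n) min≡t) d≤k)
  ... | inj₂ min≡n∸t = inj₂ (≤-trans (m≤n+m∸n n t)
        (+-monoʳ-≤ t (subst (_≤ k) (trans (circDist-offset u t<n) min≡n∸t) d≤k)))

  module _ (q : ℕ) {s s′ : ℕ} (s<s′ : s < s′) (s′<n : s′ < n) where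

    private
      gap : ∃[ t ] (1 ≤ t × s + t ≡ s′)
      gap with m≤n⇒∃[o]m+o≡n s<s′
      ... | o , 1+s+o≡s′ = suc o , s≤s z≤n , trans (+-suc s o) 1+s+o≡s′

      t = proj₁ gap
      s+t≡s′ : s + t ≡ s′
      s+t≡s′ = proj₂ (proj₂ gap)
      t<n : t < n
      t<n = ≤-<-trans (subst (t ≤_) s+t≡s′ (m≤n+m t s)) s′<n
      vertex-gap : vertex (q + s + t) ≡ vertex (q + s′)
      vertex-gap = cong vertex (trans (+-assoc q s t) (cong (q +_) s+t≡s′))
      s+[t+k]≡s′+k : s + (t + k) ≡ s′ + k
      s+[t+k]≡s′+k = trans (sym (+-assoc s t k)) (cong (_+ k) s+t≡s′)

    near⇒adj : Near s s′ → Adj n k (vertex (q + s)) (vertex (q + s′))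
    near⇒adj near = subst (Adj n k (vertex (q + s))) vertex-gap
      (offset⇒adj (q + s) (proj₁ (proj₂ gap)) t<n (gap-near near))
      where
      gap-near : Near s s′ → Near 0 t
      gap-near (inj₁ s′≤s+k)   = inj₁ (+-cancelˡ-≤ s t k (subst (_≤ s + k) (sym s+t≡s′) s′≤s+k))
      gap-near (inj₂ s+n≤s′+k) = inj₂ (+-cancelˡ-≤ s n (t + k) (subst (s + n ≤_) (sym s+[t+k]≡s′+k) s+n≤s′+k))

    adj⇒near : Adj n k (vertex (q + s)) (vertex (q + s′)) → Near s s′
    adj⇒near adj with adj⇒offset (q + s) t<n (subst (Adj n k (vertex (q + s))) (sym vertex-gap) adj)
    ... | inj₁ t≤k   = inj₁ (subst (_≤ s + k) s+t≡s′ (+-monoʳ-≤ s t≤k))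
    ... | inj₂ n≤t+k = inj₂ (subst (s + n ≤_) s+[t+k]≡s′+k (+-monoʳ-≤ s n≤t+k))

    vertex-offsets-distinct : vertex (q + s) ≢ vertex (q + s′)
    vertex-offsets-distinct eq = <-irrefl (sym (vertex-offset-injective (q + s) t<n (trans eq (sym vertex-gap))))
      (proj₁ (proj₂ gap))

  ¬adj⇒far : ∀ q {s} → 1 ≤ s → s < n → ¬ Adj n k (vertex q) (vertex (q + s)) → k < s × s + k < n
  ¬adj⇒far q {s} 1≤s s<n ¬adj with s ≤? k | n ≤? s + k
  ... | yes s≤k | _         = ⊥-elim (¬adj (offset⇒adj q 1≤s s<n (inj₁ s≤k)))
  ... | no _    | yes n≤s+k = ⊥-elim (¬adj (offset⇒adj q 1≤s s<n (inj₂ n≤s+k)))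
  ... | no s≰k  | no n≰s+k  = ≰⇒> s≰k , ≰⇒> n≰s+k

  open Bicliques (Adj n k) Adj-sym Adj-irrefl

  vertex-+0 : ∀ q → vertex (q + 0) ≡ vertex q
  vertex-+0 q = cong vertex (+-identityʳ q)

  path-biclique : ∀ q {i d} → 1 ≤ i → i ≤ k → d ≤ i + k → suc k ≤ d → d + suc (2 * k) ≤ n →
    IsBiclique (Adj n k) (pair (vertex q) (vertex (q + d)) ∪ pair (vertex (q + i)) (vertex (q + i)))
  path-biclique q {i} {d} 1≤i i≤k d≤i+k 1+k≤d bound =
    pairs-biclique xy xy zy zy ¬xz (Adj-irrefl y) outer (λ w ¬wy _ wx wz → inj₁ (inner w ¬wy wx wz))
    where
    x = vertex q
    y = vertex (q + i)
    z = vertex (q + d)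
    d+k+1+k≤n : d + k + suc k ≤ n
    d+k+1+k≤n = subst (_≤ n) (regroup d k) bound
      where
      regroup : ∀ d k → d + suc (2 * k) ≡ d + k + suc k
      regroup = solve-∀
    d<n : d < n
    d<n = ≤-trans (s≤s (≤-trans (m≤m+n d k) (m≤m+n (d + k) k))) (subst (_≤ n) (+-suc (d + k) k) d+k+1+k≤n)
    i<d : i < d
    i<d = ≤-trans (s≤s i≤k) 1+k≤d
    i<n : i < n
    i<n = <-trans i<d d<n
    xy : Adj n k x y
    xy = offset⇒adj q 1≤i i<n (inj₁ i≤k)
    zy : Adj n k z y
    zy = Adj-sym (near⇒adj q i<d d<n (inj₁ d≤i+k))
    ¬xz : ¬ Adj n k x z
    ¬xz xz with adj⇒offset q d<n xz
    ... | inj₁ d≤k   = <⇒≱ 1+k≤d d≤k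
    ... | inj₂ n≤d+k = <⇒≱ (≤-trans (s≤s (m≤m+n (d + k) k)) (subst (_≤ n) (+-suc (d + k) k) d+k+1+k≤n)) n≤d+k

    ¬adj-beyond : ∀ {s} → s < n → n ≤ s + k → ¬ Adj n k z (vertex (q + s))
    ¬adj-beyond {s} s<n n≤s+k zw = impossible (adj⇒near q d<s s<n zw)
      where
      d+1+k≤s : d + suc k ≤ s
      d+1+k≤s = +-cancelʳ-≤ k (d + suc k) s (≤-trans (≤-reflexive (regroup d k)) (≤-trans d+k+1+k≤n n≤s+k))
        where
        regroup : ∀ d k → d + suc k + k ≡ d + k + suc k
        regroup = solve-∀
      d<s : d < s
      d<s = ≤-trans (s≤s (m≤m+n d k)) (subst (_≤ s) (+-suc d k) d+1+k≤s)
      impossible : Near d s → ⊥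
      impossible (inj₁ s≤d+k)   = <⇒≱ (subst (_≤ s) (+-suc d k) d+1+k≤s) s≤d+k
      impossible (inj₂ d+n≤s+k) = <⇒≱ (+-mono-<-≤ s<n (<⇒≤ (≤-trans (s≤s ≤-refl) 1+k≤d)))
                                      (≤-trans (≤-reflexive (+-comm n d)) d+n≤s+k)

    outer : ∀ w → ¬ Adj n k w x → ¬ Adj n k w z → Adj n k w y → Adj n k w y → w ≡ x ⊎ w ≡ z
    outer w ¬wx ¬wz wy _ with vertex-offset w q
    ... | s , s<n , refl with s ≟ 0 | s ≟ d
    ...   | yes refl | _        = inj₁ (vertex-+0 q)
    ...   | no _     | yes refl = inj₂ refl
    ...   | no s≢0   | no s≢d   = ⊥-elim (byPosition (<-cmp s d))
      where
      far = ¬adj⇒far q (n≢0⇒n>0 s≢0) s<n (λ xw → ¬wx (Adj-sym xw))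
      i<s : i < s
      i<s = ≤-<-trans i≤k (proj₁ far)
      s≤i+k : s ≤ i + k
      s≤i+k with adj⇒near q i<s s<n (Adj-sym wy)
      ... | inj₁ s≤i+k   = s≤i+k
      ... | inj₂ i+n≤s+k = ⊥-elim (<⇒≱ (proj₂ far) (≤-trans (m≤n+m n i) i+n≤s+k))
      byPosition : Tri (s < d) (s ≡ d) (d < s) → ⊥
      byPosition (tri< s<d _ _) = ¬wz (near⇒adj q s<d d<n (inj₁ (≤-trans d≤i+k (+-monoˡ-≤ k (<⇒≤ i<s)))))
      byPosition (tri≈ _ s≡d _) = s≢d s≡d
      byPosition (tri> _ _ d<s) = ¬wz (Adj-sym (near⇒adj q d<s s<n (inj₁ (≤-trans s≤i+k (+-monoˡ-≤ k (<⇒≤ i<d))))))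

    inner : ∀ w → ¬ Adj n k w y → Adj n k w x → Adj n k w z → w ≡ y
    inner w ¬wy wx wz with vertex-offset w q
    ... | s , s<n , refl with s ≟ 0 | s ≟ i
    ...   | yes refl | _        = ⊥-elim (Adj-irrefl x (subst (λ v → Adj n k v x) (vertex-+0 q) wx))
    ...   | no _     | yes refl = refl
    ...   | no s≢0   | no s≢i   with adj⇒offset q s<n (Adj-sym wx)
    ...     | inj₂ n≤s+k = ⊥-elim (¬adj-beyond s<n n≤s+k (Adj-sym wz))
    ...     | inj₁ s≤k with <-cmp s i
    ...       | tri≈ _ s≡i _ = ⊥-elim (s≢i s≡i)
    ...       | tri< s<i _ _ = ⊥-elim (¬wy (near⇒adj q s<i i<n (inj₁ (≤-trans i≤k (m≤n+m k s)))))
    ...       | tri> _ _ i<s = ⊥-elim (¬wy (Adj-sym (near⇒adj q i<s s<n (inj₁ (≤-trans s≤k (m≤n+m k i))))))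

  square-biclique : n ≡ 3 * k + 2 → 2 ≤ k → ∀ q →
    IsBiclique (Adj n k) (pair (vertex q) (vertex (q + (k + 2))) ∪ pair (vertex (q + k)) (vertex (q + (2 * k + 2))))
  square-biclique n≡3k+2 2≤k q = pairs-biclique ab ad cb cd ¬ac ¬bd outer inner
    where
    a = vertex q
    b = vertex (q + k)
    c = vertex (q + (k + 2))
    d = vertex (q + (2 * k + 2))
    1≤k : 1 ≤ k
    1≤k = ≤-trans (s≤s z≤n) 2≤k
    n≡2k+2+k : n ≡ 2 * k + 2 + k
    n≡2k+2+k = trans n≡3k+2 (regroup k)
      where
      regroup : ∀ k → 3 * k + 2 ≡ 2 * k + 2 + k
      regroup = solve-∀
    2k+2≡k+2+k : 2 * k + 2 ≡ k + 2 + k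
    2k+2≡k+2+k = regroup k
      where
      regroup : ∀ k → 2 * k + 2 ≡ k + 2 + k
      regroup = solve-∀
    2k+2<n : 2 * k + 2 < n
    2k+2<n = subst (2 * k + 2 <_) (sym n≡2k+2+k) (m<m+n (2 * k + 2) 1≤k)
    k+2+k<n : k + 2 + k < n
    k+2+k<n = subst (_< n) 2k+2≡k+2+k 2k+2<n
    k<k+2 : k < k + 2
    k<k+2 = m<m+n k (s≤s z≤n)
    k+2<2k+2 : k + 2 < 2 * k + 2
    k+2<2k+2 = subst (k + 2 <_) (sym 2k+2≡k+2+k) (m<m+n (k + 2) 1≤k)
    k+2<n : k + 2 < n
    k+2<n = <-trans k+2<2k+2 2k+2<n
    k<n : k < n
    k<n = <-trans k<k+2 k+2<n

    ab : Adj n k a b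
    ab = offset⇒adj q 1≤k k<n (inj₁ ≤-refl)
    ad : Adj n k a d
    ad = offset⇒adj q (≤-trans 1≤k (<⇒≤ (<-trans k<k+2 k+2<2k+2))) 2k+2<n (inj₂ (≤-reflexive n≡2k+2+k))
    cb : Adj n k c b
    cb = Adj-sym (near⇒adj q k<k+2 k+2<n (inj₁ (subst (_≤ k + k) (+-comm 2 k) (+-monoˡ-≤ k 2≤k))))
    cd : Adj n k c d
    cd = near⇒adj q k+2<2k+2 2k+2<n (inj₁ (≤-reflexive 2k+2≡k+2+k))
    ¬ac : ¬ Adj n k a c
    ¬ac ac with adj⇒offset q k+2<n ac
    ... | inj₁ k+2≤k   = <⇒≱ k<k+2 k+2≤k
    ... | inj₂ n≤k+2+k = <⇒≱ k+2+k<n n≤k+2+k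
    ¬bd : ¬ Adj n k b d
    ¬bd bd with adj⇒near q (<-trans k<k+2 k+2<2k+2) 2k+2<n bd
    ... | inj₁ 2k+2≤k+k   = <⇒≱ (subst (λ z → k + k < k + z + 2) (sym (+-identityʳ k)) (m<m+n (k + k) (s≤s z≤n))) 2k+2≤k+k
    ... | inj₂ k+n≤2k+2+k = <⇒≱ (subst (_< k + n) n≡2k+2+k (m<n+m n 1≤k)) k+n≤2k+2+k
    outer : ∀ w → ¬ Adj n k w a → ¬ Adj n k w c → Adj n k w b → Adj n k w d → w ≡ a ⊎ w ≡ c
    outer w ¬wa ¬wc _ _ with vertex-offset w q
    ... | s , s<n , refl with s ≟ 0 | s ≟ k + 2
    ...   | yes refl | _        = inj₁ (vertex-+0 q)
    ...   | no _     | yes refl = inj₂ refl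
    ...   | no s≢0   | no s≢k+2 = ⊥-elim (byPosition (<-cmp s (k + 2)))
      where
      far = ¬adj⇒far q (n≢0⇒n>0 s≢0) s<n (λ aw → ¬wa (Adj-sym aw))
      byPosition : Tri (s < k + 2) (s ≡ k + 2) (k + 2 < s) → ⊥
      byPosition (tri< s<k+2 _ _) = ¬wc (near⇒adj q s<k+2 k+2<n
        (inj₁ (subst (_≤ s + k) (+-comm 2 k) (+-monoˡ-≤ k (≤-trans 2≤k (<⇒≤ (proj₁ far)))))))
      byPosition (tri≈ _ s≡k+2 _) = s≢k+2 s≡k+2
      byPosition (tri> _ _ k+2<s) = ¬wc (Adj-sym (near⇒adj q k+2<s s<n (inj₁ (subst (s ≤_) 2k+2≡k+2+k
        (<⇒≤ (+-cancelʳ-< k s (2 * k + 2) (subst (s + k <_) n≡2k+2+k (proj₂ far))))))))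

    inner : ∀ w → ¬ Adj n k w b → ¬ Adj n k w d → Adj n k w a → Adj n k w c → w ≡ b ⊎ w ≡ d
    inner w ¬wb ¬wd wa _ with vertex-offset w q
    ... | s , s<n , refl with s ≟ 0 | s ≟ k | s ≟ 2 * k + 2
    ...   | yes refl | _        | _        = ⊥-elim (Adj-irrefl a (subst (λ v → Adj n k v a) (vertex-+0 q) wa))
    ...   | no _     | yes refl | _        = inj₁ refl
    ...   | no _     | no _     | yes refl = inj₂ refl
    ...   | no s≢0   | no s≢k   | no s≢2k+2 with adj⇒offset q s<n (Adj-sym wa)
    ...     | inj₁ s≤k   = ⊥-elim (¬wb (near⇒adj q (≤∧≢⇒< s≤k s≢k) k<n (inj₁ (m≤n+m k s))))
    ...     | inj₂ n≤s+k = ⊥-elim (¬wd (Adj-sym (near⇒adj q 2k+2<s s<n (inj₁ (<⇒≤ (subst (s <_) n≡2k+2+k s<n))))))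
      where
      2k+2<s : 2 * k + 2 < s
      2k+2<s = ≤∧≢⇒< (+-cancelʳ-≤ k (2 * k + 2) s (subst (_≤ s + k) n≡2k+2+k n≤s+k)) (λ eq → s≢2k+2 (sym eq))

  inducedPath-offsets : ∀ {x y z} → x ≢ z → Adj n k x y → Adj n k y z → ¬ Adj n k x z →
    ∃[ q ] ∃[ i ] ∃[ j ] (i ≤ k × j ≤ k × suc k ≤ i + j × y ≡ vertex (q + i) ×
      (x ≡ vertex q × z ≡ vertex (q + (i + j)) ⊎ z ≡ vertex q × x ≡ vertex (q + (i + j))))
  inducedPath-offsets {x} {y} {z} x≢z xy yz ¬xz with vertex-offset y (toℕ x) | vertex-offset z (toℕ x)
  ... | s , s<n , refl | s′ , s′<n , refl = byNear (adj⇒offset p s<n (subst (λ v → Adj n k v (vertex (p + s))) x≡ xy))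
    where
    p = toℕ x
    x≡ : x ≡ vertex p
    x≡ = sym (vertex-toℕ x)
    s′≢0 : s′ ≢ 0
    s′≢0 refl = x≢z (trans x≡ (sym (vertex-+0 p)))
    far : k < s′ × s′ + k < n
    far = ¬adj⇒far p (n≢0⇒n>0 s′≢0) s′<n (subst (λ v → ¬ Adj n k v (vertex (p + s′))) x≡ ¬xz)
    byNear : Near 0 s → ∃[ q ] ∃[ i ] ∃[ j ] (i ≤ k × j ≤ k × suc k ≤ i + j × vertex (p + s) ≡ vertex (q + i) ×
      (x ≡ vertex q × vertex (p + s′) ≡ vertex (q + (i + j)) ⊎ vertex (p + s′) ≡ vertex q × x ≡ vertex (q + (i + j))))
    byNear (inj₁ s≤k) =
      p , s , s′ ∸ s , s≤k , m≤n+o⇒m∸n≤o s′ s s′≤s+k , subst (suc k ≤_) (sym s+[s′∸s]≡s′) (proj₁ far) , refl ,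
      inj₁ (x≡ , cong (λ t → vertex (p + t)) (sym s+[s′∸s]≡s′))
      where
      s<s′ : s < s′
      s<s′ = ≤-<-trans s≤k (proj₁ far)
      s+[s′∸s]≡s′ : s + (s′ ∸ s) ≡ s′
      s+[s′∸s]≡s′ = m+[n∸m]≡n (<⇒≤ s<s′)
      s′≤s+k : s′ ≤ s + k
      s′≤s+k with adj⇒near p s<s′ s′<n yz
      ... | inj₁ s′≤s+k   = s′≤s+k
      ... | inj₂ s+n≤s′+k = ⊥-elim (<⇒≱ (proj₂ far) (≤-trans (m≤n+m n s) s+n≤s′+k))
    byNear (inj₂ n≤s+k) =
      p + s′ , s ∸ s′ , n ∸ s , m≤n+o⇒m∸n≤o s s′ s≤s′+k , m≤n+o⇒m∸n≤o n s n≤s+k ,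
      +-cancelˡ-≤ s′ (suc k) _ (subst (s′ + suc k ≤_) (sym s′+[i+j]≡n) (subst (_≤ n) (sym (+-suc s′ k)) (proj₂ far))) ,
      cong vertex (trans (cong (p +_) (sym s′+[s∸s′]≡s)) (sym (+-assoc p s′ (s ∸ s′)))) ,
      inj₂ (refl , (begin
        x                                   ≡⟨ x≡ ⟩
        vertex p                            ≡⟨ sym (vertex-+n p) ⟩
        vertex (p + n)                      ≡⟨ cong (λ t → vertex (p + t)) (sym s′+[i+j]≡n) ⟩
        vertex (p + (s′ + ((s ∸ s′) + (n ∸ s)))) ≡⟨ cong vertex (sym (+-assoc p s′ _)) ⟩
        vertex (p + s′ + ((s ∸ s′) + (n ∸ s)))  ∎))
      where
      open ≡-Reasoning
      s′<s : s′ < s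
      s′<s = +-cancelʳ-< k s′ s (<-≤-trans (proj₂ far) n≤s+k)
      s′+[s∸s′]≡s : s′ + (s ∸ s′) ≡ s
      s′+[s∸s′]≡s = m+[n∸m]≡n (<⇒≤ s′<s)
      s′+[i+j]≡n : s′ + ((s ∸ s′) + (n ∸ s)) ≡ n
      s′+[i+j]≡n = trans (sym (+-assoc s′ (s ∸ s′) (n ∸ s)))
                         (trans (cong (_+ (n ∸ s)) s′+[s∸s′]≡s) (m+[n∸m]≡n (<⇒≤ s<n)))
      s≤s′+k : s ≤ s′ + k
      s≤s′+k with adj⇒near p s′<s s<n (Adj-sym yz)
      ... | inj₁ s≤s′+k   = s≤s′+k
      ... | inj₂ s′+n≤s+k = ⊥-elim (<⇒≱ (subst (s + k <_) (+-comm n s′) (+-mono-< s<n (proj₁ far))) s′+n≤s+k)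

  privateNeighbour : 1 ≤ k → 3 * k + 2 ≤ n → ∀ {x y} → Adj n k x y → ∃[ w ] (Adj n k w x × ¬ Adj n k w y × w ≢ y)
  privateNeighbour 1≤k 3k+2≤n {x} {y} xy with vertex-offset y (toℕ x)
  ... | s , s<n , refl = byNear (adj⇒offset p s<n xy′)
    where
    p = toℕ x
    x≡ : x ≡ vertex p
    x≡ = sym (vertex-toℕ x)
    xy′ : Adj n k (vertex p) (vertex (p + s))
    xy′ = subst (λ v → Adj n k v (vertex (p + s))) x≡ xy
    neighbour : ∀ {t} → 1 ≤ t → t < n → Near 0 t → Adj n k (vertex (p + t)) x
    neighbour {t} 1≤t t<n near = subst (Adj n k (vertex (p + t))) (sym x≡) (Adj-sym (offset⇒adj p 1≤t t<n near))
    1≤s : 1 ≤ s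
    1≤s = n≢0⇒n>0 λ { refl → Adj-irrefl _ (subst (λ v → Adj n k v (vertex (p + 0))) (sym (vertex-+0 p)) xy′) }
    3k<n : k + k + k < n
    3k<n = ≤-trans (m≤m+n (suc (k + k + k)) 1) (subst (_≤ n) (regroup k) 3k+2≤n)
      where
      regroup : ∀ k → 3 * k + 2 ≡ suc (k + k + k) + 1
      regroup = solve-∀
    k<n : k < n
    k<n = ≤-<-trans (≤-trans (m≤m+n k k) (m≤m+n (k + k) k)) 3k<n
    byNear : Near 0 s → ∃[ w ] (Adj n k w x × ¬ Adj n k w (vertex (p + s)) × w ≢ vertex (p + s))
    byNear (inj₁ s≤k) = vertex (p + (n ∸ k)) ,
      neighbour (m<n⇒0<n∸m k<n) n∸k<n (inj₂ (≤-reflexive (sym (m∸n+n≡m (<⇒≤ k<n))))) ,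
      (λ wy → impossible (adj⇒near p s<n∸k n∸k<n (Adj-sym wy))) ,
      (λ w≡y → vertex-offsets-distinct p s<n∸k n∸k<n (sym w≡y))
      where
      n∸k<n : n ∸ k < n
      n∸k<n = ∸-monoʳ-< 1≤k (<⇒≤ k<n)
      k+k<n∸k : k + k < n ∸ k
      k+k<n∸k = m+n≤o⇒m≤o∸n (suc (k + k)) 3k<n
      s<n∸k : s < n ∸ k
      s<n∸k = ≤-<-trans (≤-trans s≤k (m≤m+n k k)) k+k<n∸k
      impossible : Near s (n ∸ k) → ⊥
      impossible (inj₁ n∸k≤s+k) = <⇒≱ (≤-<-trans (+-monoˡ-≤ k s≤k) k+k<n∸k) n∸k≤s+k
      impossible (inj₂ s+n≤n∸k+k) = <⇒≱ (m<n+m n 1≤s) (≤-trans s+n≤n∸k+k (≤-reflexive (m∸n+n≡m (<⇒≤ k<n))))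
    byNear (inj₂ n≤s+k) = vertex (p + k) ,
      neighbour 1≤k k<n (inj₁ ≤-refl) ,
      (λ wy → impossible (adj⇒near p k<s s<n wy)) ,
      vertex-offsets-distinct p k<s s<n
      where
      k+k<s : k + k < s
      k+k<s = +-cancelʳ-< k (k + k) s (<-≤-trans 3k<n n≤s+k)
      k<s : k < s
      k<s = ≤-<-trans (m≤m+n k k) k+k<s
      impossible : Near k s → ⊥
      impossible (inj₁ s≤k+k)   = <⇒≱ k+k<s s≤k+k
      impossible (inj₂ k+n≤s+k) = <⇒≱ s<n (+-cancelˡ-≤ k n s (subst (k + n ≤_) (+-comm s k) k+n≤s+k))

toParity : Fin 2 → Parity
toParity zero       = 0ℙ
toParity (suc zero) = 1ℙ

toParity-injective : ∀ {a b} → toParity a ≡ toParity b → a ≡ b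
toParity-injective {zero}     {zero}     _ = refl
toParity-injective {suc zero} {suc zero} _ = refl
toParity-injective {zero}     {suc zero} ()
toParity-injective {suc zero} {zero}     ()

fromParity : Parity → Fin 2
fromParity 0ℙ = zero
fromParity 1ℙ = suc zero

fromParity-injective : ∀ {p q} → fromParity p ≡ fromParity q → p ≡ q
fromParity-injective {0ℙ} {0ℙ} _ = refl
fromParity-injective {1ℙ} {1ℙ} _ = refl
fromParity-injective {0ℙ} {1ℙ} ()
fromParity-injective {1ℙ} {0ℙ} ()

module Characterisation (k n : ℕ) .{{_ : NonZero n}} (1≤k : 1 ≤ k) (3k+2≤n : 3 * k + 2 ≤ n) where

  open CyclePower n k
  open Bicliques (Adj n k) Adj-sym Adj-irrefl

  bicliqueColouring⇒evenPartition : ∀ {c : Fin n → Fin 2} → IsBicliqueColouring (Adj n k) c → EvenPartition n k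
  bicliqueColouring⇒evenPartition {c} colouring =
    Necessity.necessity n k sequence (λ u → cong (toParity ∘ c) (vertex-+n u)) 1≤k 3k+2≤n avoidsPaths avoidsSquares
    where
    sequence : ℕ → Parity
    sequence u = toParity (c (vertex u))
    avoidsPaths : AvoidsPaths n k sequence
    avoidsPaths q i d 1≤i i≤k d≤i+k 1+k≤d bound same₁ same₂ =
      colouring _ (path-biclique q 1≤i i≤k d≤i+k 1+k≤d bound)
        (pairs-monochromatic c (toParity-injective same₁) (toParity-injective same₂) (toParity-injective same₁))
    avoidsSquares : AvoidsSquares n k sequence
    avoidsSquares n≡3k+2 2≤k q same₁ same₂ same₃ =
      colouring _ (square-biclique n≡3k+2 2≤k q)
        (pairs-monochromatic c (toParity-injective same₁) (toParity-injective same₂) (toParity-injective same₃))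

  evenPartition⇒bicliqueColourable : EvenPartition n k → BicliqueColourable (Adj n k) 2
  evenPartition⇒bicliqueColourable (a , b , n≡ak+b[k+1] , _ , 2∣a+b) = colouring , isColouring
    where
    n≡k[a+b]+b : n ≡ k * (a + b) + b
    n≡k[a+b]+b = trans n≡ak+b[k+1] (regroup a b k)
      where
      regroup : ∀ a b k → a * k + b * (k + 1) ≡ k * (a + b) + b
      regroup = solve-∀
    k[a+b]≤n : k * (a + b) ≤ n
    k[a+b]≤n = subst (k * (a + b) ≤_) (sym n≡k[a+b]+b) (m≤m+n (k * (a + b)) b)
    n≤[1+k][a+b] : n ≤ suc k * (a + b)
    n≤[1+k][a+b] = subst (_≤ suc k * (a + b)) (sym n≡k[a+b]+b)
      (≤-trans (+-monoʳ-≤ (k * (a + b)) (m≤n+m b a)) (≤-reflexive (+-comm (k * (a + b)) (a + b))))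
    open FloorColouring n k (a + b) 2∣a+b k[a+b]≤n n≤[1+k][a+b]
    colouring : Fin n → Fin 2
    colouring x = fromParity (colour (toℕ x))
    sameColour : ∀ {u v} → colouring (vertex u) ≡ colouring (vertex v) → colour u ≡ colour v
    sameColour {u} {v} eq = fromParity-injective (begin
      fromParity (colour u)          ≡⟨ cong fromParity (sym (colour-mod u)) ⟩
      fromParity (colour (u % n))    ≡⟨ cong (fromParity ∘ colour) (sym (toℕ-vertex u)) ⟩
      colouring (vertex u)           ≡⟨ eq ⟩
      colouring (vertex v)           ≡⟨ cong (fromParity ∘ colour) (toℕ-vertex v) ⟩
      fromParity (colour (v % n))    ≡⟨ cong fromParity (colour-mod v) ⟩
      fromParity (colour v)          ∎)
      where open ≡-Reasoning
    isColouring : IsBicliqueColouring (Adj n k) colouring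
    isColouring S isBiclique mono with biclique⇒inducedPath (privateNeighbour 1≤k 3k+2≤n) isBiclique
    ... | x , y , z , x∈S , y∈S , z∈S , x≢z , xy , yz , ¬xz with inducedPath-offsets x≢z xy yz ¬xz
    ... | q , i , j , i≤k , j≤k , 1+k≤i+j , refl , inj₁ (refl , refl) =
      no-monochromatic-path q i≤k j≤k 1+k≤i+j (sameColour (mono _ _ x∈S y∈S)) (sameColour (mono _ _ x∈S z∈S))
    ... | q , i , j , i≤k , j≤k , 1+k≤i+j , refl , inj₂ (refl , refl) =
      no-monochromatic-path q i≤k j≤k 1+k≤i+j (sameColour (mono _ _ z∈S y∈S)) (sameColour (mono _ _ z∈S x∈S))

  fewerColours-impossible : ∀ m → m < 2 → ¬ BicliqueColourable (Adj n k) m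
  fewerColours-impossible zero    _ (c , _) with c (vertex 0)
  ... | ()
  fewerColours-impossible (suc zero) _ (c , colouring) =
    colouring _ (path-biclique 0 ≤-refl 1≤k ≤-refl ≤-refl (3k+2≤n⇒1+k+[1+2k]≤n k 3k+2≤n))
      λ u v _ _ → oneColour (c u) (c v)
    where
    oneColour : ∀ (p q : Fin 1) → p ≡ q
    oneColour zero zero = refl
  fewerColours-impossible (suc (suc _)) (s≤s (s≤s ()))

theorem7 : (k n : ℕ) → 1 ≤ k → 3 * k + 2 ≤ n →
    BicliqueChromaticNumber (Adj n k) 2 ⇔
      (∃[ a ] ∃[ b ] (n ≡ a * k + b * (k + 1) × 2 ≤ a + b × 2 ∣ a + b))
theorem7 k n 1≤k 3k+2≤n = mk⇔
  (λ ((_ , isColouring) , _) → bicliqueColouring⇒evenPartition isColouring)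
  (λ partition → evenPartition⇒bicliqueColourable partition , fewerColours-impossible)
  where
  instance
    n-nonZero : NonZero n
    n-nonZero = >-nonZero (3k+2≤n⇒0<n k 3k+2≤n)
  open Characterisation k n 1≤k 3k+2≤n
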